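{- For integers $n\geq 0$, $0\le m\le n$, $0\le k\le n$ and $0\le r\le n$, let $N(n,m,k,r)$ be the number of Boolean functions $f:\{0,1\}^n\to\{0,1\}$ with exactly $m$ essential variables, canalizing depth $k$ and $r$ canalizing layers, and let $C(n,k,r)$ be the number of Boolean functions $f:\{0,1\}^n\to\{0,1\}$ with canalizing depth $k$ and $r$ canalizing layers (regardless of the number of essential variables). Then $$N(n,m,k,r) = \begin{cases} 0 & \text{if } m<k \text{ or } k<r,\\ 2 & \text{if } m=k=r=0,\\ \binom{n}{m}N(m,m,k,r) & \text{if } k\leq m < n,\\ C(n,k,r) - \sum_{i=0}^{n-1} N(n,i,k,r) & \text{if } m=n. \end{cases}$$
   Context: Boolean functions are maps $f:\{0,1\}^n\to\{0,1\}$ in variables $x_1,\dots,x_n$, viewed as polynomials over $\mathbb{F}_2=\{0,1\}$. The function $f$ is essential in $x_i$ if there is $\mathbf{x}\in\{0,1\}^n$ with $f(\mathbf{x})\neq f(\mathbf{x}\oplus e_i)$, where $\oplus$ is addition mod 2 and $e_i$ the $i$th unit vector; such $x_i$ is an essential variable. A function $f$ is canalizing if there exist a variable $x_i$, a Boolean function $g$ of the remaining variables, and $a,b\in\{0,1\}$ such that $f=b$ whenever $x_i=a$ and $f=g$ whenever $x_i\neq a$, with $g\not\equiv b$ (so constant functions are not canalizing). For $1\le k\le n$, $f$ is $k$-canalizing with respect to a permutation $\sigma$ of $\{1,\dots,n\}$, inputs $a_1,\dots,a_k$ and outputs $b_1,\dots,b_k$ if: $f=b_1$ when $x_{\sigma(1)}=a_1$;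 $f=b_j$ when $x_{\sigma(1)}\ne a_1,\dots,x_{\sigma(j-1)}\neq a_{j-1}, x_{\sigma(j)}=a_j$ for $2\le j\le k$; and $f=g$ when $x_{\sigma(1)}\ne a_1,\dots,x_{\sigma(k)}\neq a_k$, where $g=g(x_{\sigma(k+1)},\dots,x_{\sigma(n)})$ is a Boolean function with $g\not\equiv b_k$. If moreover $g$ is not canalizing, $k$ is the canalizing depth of $f$. Non-canalizing functions have canalizing depth $0$. Number of canalizing layers: it is known that every Boolean function $f\not\equiv 0$ can be uniquely written as $f = M_1(M_2(\cdots (M_{r-1}(M_r p_C + 1) + 1)\cdots)+ 1)+ q$ with $q\in\{0,1\}$, where each $M_i=\prod_{j=1}^{k_i}(x_{i_j}+a_{i_j})$ is a non-constant extended monomial ($a_{i_j}\in\{0,1\}$), $\sum_i k_i=k$ is the canalizing depth, $p_C$ is the core polynomial, each variable appears in exactly one of $M_1,\dots,M_r,p_C$, subject only to: (i) if $p_C\equiv 1$ and $r\ne 1$ then $k_r\ge 2$; (ii) if $p_C\equiv1$, $r=1$ and $k_1=1$ then $q=0$; when $k=0$, $r=0$ and $p_C=f$. The number $r$ is the number of canalizing layers of $f$ (constant functions have $k=r=0$). Informally, $M_1$ contains the variables that are canalizing, $M_2$ those that become canalizing after excluding the first-layer variables, etc. -}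

module Defs where

-- Everything is finite, so all predicates are decidable; the
-- decision procedures (by exhaustive search) are provided below so that the
-- counts are genuine functions ℕ → ℕ.

open import Data.Bool using (Bool; true; false; not; _∧_; _xor_; if_then_else_)
open import Data.Bool.Properties using () renaming (_≟_ to _≟B_)
open import Data.Nat using (ℕ; zero; suc; _≤_) renaming (_≟_ to _≟ℕ_; _≤?_ to _≤?ℕ_)
open import Data.Fin using (Fin; zero; suc; fromℕ) renaming (_<_ to _<F_; _≟_ to _≟F_)
open import Data.Fin.Properties using (any?) renaming (_<?_ to _<?F_)
open import Data.Vec using (Vec; []; _∷_; lookup; _[_]%=_)
open import Data.Maybe using (Maybe; just; nothing)
open import Data.Maybe.Properties using (≡-dec)
open import Data.Product using (Σ; _×_; _,_; proj₁; proj₂)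
open import Data.Sum using (_⊎_; inj₁; inj₂)
open import Data.List using (List; []; _∷_; length; filter; map; allFin; foldr; cartesianProduct)
open import Relation.Nullary using (Dec; yes; no; ¬_; ¬?)
open import Relation.Nullary.Decidable using (_×-dec_; _⊎-dec_; _→-dec_; decidable-stable)
open import Relation.Binary.PropositionalEquality using (_≡_; _≢_; refl)

Input : ℕ → Set
Input n = Vec Bool n

Fun : ℕ → Set
Fun n = Input n → Bool

-- Boolean functions as (Shannon) truth tables: BF (suc n) = (f|x₁=0 , f|x₁=1).
-- 'eval' is a bijection between BF n and Fun n up to pointwise equality,
-- so BF n is exactly the (finite) set of Boolean functions in n variables.
BF : ℕ → Set
BF zero    = Bool
BF (suc n) = BF n × BF n

eval : ∀ {n} → BF n → Fun n
eval {zero}  b         []          = b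
eval {suc n} (f₀ , f₁) (false ∷ x) = eval f₀ x
eval {suc n} (f₀ , f₁) (true  ∷ x) = eval f₁ x

allBF : ∀ n → List (BF n)
allBF zero    = false ∷ true ∷ []
allBF (suc n) = cartesianProduct (allBF n) (allBF n)

flipAt : ∀ {n} → Input n → Fin n → Input n
flipAt x i = x [ i ]%= not

Essential : ∀ {n} → Fun n → Fin n → Set
Essential {n} f i = Σ (Input n) λ x → f x ≢ f (flipAt x i)

Avoids : ∀ {n k} → Vec (Fin n) k → Vec Bool k → Input n → Set
Avoids σ a x = ∀ l → lookup x (lookup σ l) ≢ lookup a l

-- 'CanalizingOn σ a f': the function g = f restricted to the region
-- 'Avoids σ a' (a Boolean function of the remaining variables
-- x_i, i ∉ {σ(1..k)}) is canalizing: there are a remaining variable x_i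
-- and c, d ∈ {0,1} with g = d whenever x_i = c, and g ≢ d on x_i ≠ c.
CanalizingOn : ∀ {n k} → Vec (Fin n) k → Vec Bool k → Fun n → Set
CanalizingOn {n} σ a f =
  Σ (Fin n) λ i → (∀ l → lookup σ l ≢ i) × Σ Bool λ c → Σ Bool λ d →
    (∀ x → Avoids σ a x → lookup x i ≡ c → f x ≡ d) ×
    (Σ (Input n) λ x → Avoids σ a x × lookup x i ≢ c × f x ≢ d)

Canalizing : ∀ {n} → Fun n → Set
Canalizing f = CanalizingOn [] [] f

Distinct : ∀ {n k} → Vec (Fin n) k → Set
Distinct {k = k} σ = (i j : Fin k) → lookup σ i ≡ lookup σ j → i ≡ j

KCanalizing : ∀ {n k} → Fun n → Vec (Fin n) (suc k) → Vec Bool (suc k) → Vec Bool (suc k) → Set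
KCanalizing {n} {k} f σ a b =
  (∀ (j : Fin (suc k)) (x : Input n) →
     (∀ l → l <F j → lookup x (lookup σ l) ≢ lookup a l) →
     lookup x (lookup σ j) ≡ lookup a j → f x ≡ lookup b j) ×
  (Σ (Input n) λ x → Avoids σ a x × f x ≢ lookup b (fromℕ k))

HasDepth : ∀ {n} → Fun n → ℕ → Set
HasDepth f zero = ¬ Canalizing f
HasDepth {n} f (suc k) =
  Σ (Vec (Fin n) (suc k)) λ σ → Distinct σ ×
  Σ (Vec Bool (suc k)) λ a → Σ (Vec Bool (suc k)) λ b →
    KCanalizing f σ a b × ¬ CanalizingOn σ a f

-- A candidate representation with r layers:
--   layer j = just i : variable x_j occurs in M_{i+1};  nothing : x_j is a
--                      variable of the core polynomial p_C
--   sign j           : the constant a_j in the factor (x_j + a_j)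
--   core             : p_C (required below to depend only on core variables)
--   q                : the final constant
Rep : ℕ → ℕ → Set
Rep n r = Vec (Maybe (Fin r)) n × Vec Bool n × BF n × Bool

layer : ∀ {n r} → Rep n r → Vec (Maybe (Fin r)) n
layer (L , _ , _ , _) = L

sign : ∀ {n r} → Rep n r → Vec Bool n
sign (_ , a , _ , _) = a

core : ∀ {n r} → Rep n r → BF n
core (_ , _ , p , _) = p

qconst : ∀ {n r} → Rep n r → Bool
qconst (_ , _ , _ , q) = q

InLayer : ∀ {n r} → Rep n r → Fin r → Fin n → Set
InLayer ρ i j = lookup (layer ρ) j ≡ just i

inLayer? : ∀ {n r} (ρ : Rep n r) (i : Fin r) (j : Fin n) → Dec (InLayer ρ i j)
inLayer? ρ i j = ≡-dec _≟F_ (lookup (layer ρ) j) (just i)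

layerSize : ∀ {n r} → Rep n r → Fin r → ℕ
layerSize {n} ρ i = length (filter (inLayer? ρ i) (allFin n))

monomial : ∀ {n r} → Rep n r → Fin r → Input n → Bool
monomial {n} ρ i x =
  foldr _∧_ true
    (map (λ j → if Dec.does (inLayer? ρ i j)
                  then lookup x j xor lookup (sign ρ) j
                  else true)
         (allFin n))
  where open Relation.Nullary

nest : List Bool → Bool → Bool
nest []              p = p
nest (m ∷ [])        p = m ∧ p
nest (m ∷ ms@(_ ∷ _)) p = m ∧ not (nest ms p)

repEval : ∀ {n r} → Rep n r → Fun n
repEval {r = r} ρ x =
  nest (map (λ i → monomial ρ i x) (allFin r)) (eval (core ρ) x) xor qconst ρ

CoreOne : ∀ {n r} → Rep n r → Set
CoreOne {n} ρ = ∀ (x : Input n) → eval (core ρ) x ≡ true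

-- side conditions (i) and (ii) (and q = 0 when r = 0, i.e. p_C = f)
SideCond : ∀ {n} r → Rep n r → Set
SideCond zero          ρ = qconst ρ ≡ false
SideCond (suc zero)    ρ = CoreOne ρ → layerSize ρ zero ≡ 1 → qconst ρ ≡ false
SideCond (suc (suc r)) ρ = CoreOne ρ → 2 ≤ layerSize ρ (fromℕ (suc r))

ValidRep : ∀ {n r} → Rep n r → Set
ValidRep {n} {r} ρ =
  (∀ (i : Fin r) → 1 ≤ layerSize ρ i) ×
  (∀ (j : Fin n) → lookup (layer ρ) j ≢ nothing → ¬ Essential (eval (core ρ)) j) ×
  (Σ (Input n) λ x → eval (core ρ) x ≡ true) ×
  ¬ Canalizing (eval (core ρ)) ×
  SideCond r ρ

HasLayers : ∀ {n} → Fun n → ℕ → Set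
HasLayers {n} f r =
  ((∀ x → f x ≡ false) × r ≡ 0) ⊎
  ((Σ (Input n) λ x → f x ≡ true) ×
   Σ (Rep n r) λ ρ → ValidRep ρ × (∀ x → f x ≡ repEval ρ x))

Searchable : Set → Set₁
Searchable A = (P : A → Set) → (∀ a → Dec (P a)) → Dec (Σ A P)

searchBool : Searchable Bool
searchBool P d with d false | d true
... | yes p | _     = yes (false , p)
... | no _  | yes p = yes (true , p)
... | no ¬f | no ¬t = no λ { (false , p) → ¬f p ; (true , p) → ¬t p }

searchFin : ∀ {n} → Searchable (Fin n)
searchFin P d = any? d

search× : ∀ {A B : Set} → Searchable A → Searchable B → Searchable (A × B)
search× {A} {B} sA sB P d with sA (λ a → Σ B λ b → P (a , b)) (λ a → sB (λ b → P (a , b)) (λ b → d (a , b)))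
... | yes (a , b , p) = yes ((a , b) , p)
... | no ¬h = no λ { ((a , b) , p) → ¬h (a , b , p) }

searchMaybe : ∀ {A : Set} → Searchable A → Searchable (Maybe A)
searchMaybe sA P d with d nothing | sA (λ a → P (just a)) (λ a → d (just a))
... | yes p | _ = yes (nothing , p)
... | no _ | yes (a , p) = yes (just a , p)
... | no ¬n | no ¬j = no λ { (nothing , p) → ¬n p ; (just a , p) → ¬j (a , p) }

searchVec : ∀ {A : Set} → Searchable A → ∀ n → Searchable (Vec A n)
searchVec sA zero P d with d []
... | yes p = yes ([] , p)
... | no ¬p = no λ { ([] , p) → ¬p p }
searchVec {A} sA (suc n) P d with search× sA (searchVec sA n) (λ { (a , v) → P (a ∷ v) }) (λ { (a , v) → d (a ∷ v) })
... | yes ((a , v) , p) = yes (a ∷ v , p)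
... | no ¬h = no λ { (a ∷ v , p) → ¬h ((a , v) , p) }

searchBF : ∀ n → Searchable (BF n)
searchBF zero    = searchBool
searchBF (suc n) = search× (searchBF n) (searchBF n)

searchAll : ∀ {A : Set} → Searchable A → (P : A → Set) → (∀ a → Dec (P a)) → Dec (∀ a → P a)
searchAll sA P d with sA (λ a → ¬ P a) (λ a → ¬? (d a))
... | yes (a , ¬p) = no λ h → ¬p (h a)
... | no ¬h = yes λ a → decidable-stable (d a) (λ ¬p → ¬h (a , ¬p))

searchInput : ∀ n → Searchable (Input n)
searchInput n = searchVec searchBool n

searchRep : ∀ n r → Searchable (Rep n r)
searchRep n r = search× (searchVec (searchMaybe searchFin) n)
                  (search× (searchVec searchBool n) (search× (searchBF n) searchBool))

essential? : ∀ {n} (f : Fun n) (i : Fin n) → Dec (Essential f i)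
essential? {n} f i = searchInput n _ (λ x → ¬? (f x ≟B f (flipAt x i)))

avoids? : ∀ {n k} (σ : Vec (Fin n) k) (a : Vec Bool k) (x : Input n) → Dec (Avoids σ a x)
avoids? σ a x = searchAll searchFin _ (λ l → ¬? (lookup x (lookup σ l) ≟B lookup a l))

canalizingOn? : ∀ {n k} (σ : Vec (Fin n) k) (a : Vec Bool k) (f : Fun n) → Dec (CanalizingOn σ a f)
canalizingOn? {n} σ a f =
  searchFin _ λ i →
    searchAll searchFin _ (λ l → ¬? (lookup σ l ≟F i)) ×-dec
    searchBool _ λ c → searchBool _ λ d →
      searchAll (searchInput n) _ (λ x →
        avoids? σ a x →-dec ((lookup x i ≟B c) →-dec (f x ≟B d))) ×-dec
      searchInput n _ (λ x →
        avoids? σ a x ×-dec (¬? (lookup x i ≟B c) ×-dec ¬? (f x ≟B d)))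

canalizing? : ∀ {n} (f : Fun n) → Dec (Canalizing f)
canalizing? f = canalizingOn? [] [] f

distinct? : ∀ {n k} (σ : Vec (Fin n) k) → Dec (Distinct σ)
distinct? σ = searchAll searchFin _ λ i → searchAll searchFin _ λ j →
  (lookup σ i ≟F lookup σ j) →-dec (i ≟F j)

kCanalizing? : ∀ {n k} (f : Fun n) σ a b → Dec (KCanalizing {n} {k} f σ a b)
kCanalizing? {n} {k} f σ a b =
  searchAll searchFin _ (λ j → searchAll (searchInput n) _ λ x →
    searchAll searchFin _ (λ l → (l <?F j) →-dec ¬? (lookup x (lookup σ l) ≟B lookup a l))
      →-dec ((lookup x (lookup σ j) ≟B lookup a j) →-dec (f x ≟B lookup b j)))
  ×-dec
  searchInput n _ (λ x → avoids? σ a x ×-dec ¬? (f x ≟B lookup b (fromℕ k)))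

hasDepth? : ∀ {n} (f : Fun n) (k : ℕ) → Dec (HasDepth f k)
hasDepth? f zero = ¬? (canalizing? f)
hasDepth? {n} f (suc k) =
  searchVec searchFin (suc k) _ λ σ → distinct? σ ×-dec
  searchVec searchBool (suc k) _ λ a → searchVec searchBool (suc k) _ λ b →
    kCanalizing? f σ a b ×-dec ¬? (canalizingOn? σ a f)

coreOne? : ∀ {n r} (ρ : Rep n r) → Dec (CoreOne ρ)
coreOne? {n} ρ = searchAll (searchInput n) _ (λ x → eval (core ρ) x ≟B true)

sideCond? : ∀ {n} r (ρ : Rep n r) → Dec (SideCond r ρ)
sideCond? zero          ρ = qconst ρ ≟B false
sideCond? (suc zero)    ρ = coreOne? ρ →-dec ((layerSize ρ zero ≟ℕ 1) →-dec (qconst ρ ≟B false))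
sideCond? (suc (suc r)) ρ = coreOne? ρ →-dec (2 ≤?ℕ layerSize ρ (fromℕ (suc r)))

validRep? : ∀ {n r} (ρ : Rep n r) → Dec (ValidRep ρ)
validRep? {n} {r} ρ =
  searchAll searchFin _ (λ i → 1 ≤?ℕ layerSize ρ i) ×-dec
  (searchAll searchFin _ (λ j →
     ¬? (≡-dec _≟F_ (lookup (layer ρ) j) nothing) →-dec ¬? (essential? (eval (core ρ)) j)) ×-dec
  (searchInput n _ (λ x → eval (core ρ) x ≟B true) ×-dec
  (¬? (canalizing? (eval (core ρ))) ×-dec
  sideCond? r ρ)))

hasLayers? : ∀ {n} (f : Fun n) (r : ℕ) → Dec (HasLayers f r)
hasLayers? {n} f r =
  (searchAll (searchInput n) _ (λ x → f x ≟B false) ×-dec (r ≟ℕ 0)) ⊎-dec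
  (searchInput n _ (λ x → f x ≟B true) ×-dec
   searchRep n r _ (λ ρ → validRep? ρ ×-dec
     searchAll (searchInput n) _ (λ x → f x ≟B repEval ρ x)))

count : ∀ n (P : Fun n → Set) → (∀ f → Dec (P f)) → ℕ
count n P P? = length (filter (λ f → P? (eval f)) (allBF n))

numEssential : ∀ {n} → Fun n → ℕ
numEssential {n} f = length (filter (essential? f) (allFin n))

N : ℕ → ℕ → ℕ → ℕ → ℕ
N n m k r = count n (λ f → numEssential f ≡ m × HasDepth f k × HasLayers f r)
                    (λ f → (numEssential f ≟ℕ m) ×-dec (hasDepth? f k ×-dec hasLayers? f r))

-- Cnt n k r = C(n,k,r): functions with canalizing depth k and r canalizing layers
Cnt : ℕ → ℕ → ℕ → ℕ
Cnt n k r = count n (λ f → HasDepth f k × HasLayers f r)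
                  (λ f → hasDepth? f k ×-dec hasLayers? f r)

module Submission where

-- Canalizing steps, taken inside the region left by the previous ones, form a diamond: steps on
-- two different variables stay steps after each other, and a variable canalizing with both
-- values leaves nothing to canalize.  So all maximal chains of steps have the same length, the
-- canalizing depth k, and as every step variable is essential, k ≤ m.  A layer representation
-- M₁(M₂(⋯(M_r p_C + 1)⋯) + 1) + q gives a chain through all variables of M₁, then of M₂, and so
-- on, so r ≤ k.  Adding or deleting a dummy variable changes neither m, k nor r; double counting
-- the pairs (f, x_j) with x_j inessential in f then gives (n+1−m)·N(n+1,m,k,r) = (n+1)·N(n,m,k,r),
-- hence N(n,m,k,r) = C(n,m)·N(m,m,k,r).  For m = k = r = 0 only the two constants remain, and
-- C(n,k,r) is the sum of N(n,i,k,r) over i ≤ n.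

open import Defs
open import Data.Bool using (Bool; true; false; not; _∧_; _xor_; if_then_else_)
open import Data.Bool.Properties using (¬-not; not-injective; xor-same; xor-identityʳ) renaming (_≟_ to _≟B_)
open import Data.Nat using (ℕ; zero; suc; pred; _+_; _*_; _∸_; _≤_; _<_; _!; NonZero; z≤n; s≤s) renaming (_≟_ to _≟ℕ_; _≤?_ to _≤?ℕ_)
import Data.Nat.Properties as ℕ
open import Data.Nat.Combinatorics using (_C_; nCn≡1; k![n∸k]!∣n!)
open import Data.Nat.Combinatorics.Specification using (nCk≡n!/k![n-k]!)
open import Data.Nat.DivMod using (m/n*n≡m)
open import Data.Nat.Tactic.RingSolver using (solve-∀)
open import Data.Nat.ListAction using (sum)
open import Data.Nat.ListAction.Properties using (sum-++)
open import Algebra.Properties.Semiring.Sum ℕ.+-*-semiring using (sum-syntax; sum-remove; sum-cong-≗; ∑-distrib-+; *-distribʳ-sum)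
open import Algebra.Properties.CommutativeSemigroup ℕ.+-commutativeSemigroup using (interchange)
open import Data.Integer using (ℤ; +_; _-_; _⊖_)
import Data.Integer.Properties as ℤ
open import Data.Fin using (Fin; zero; suc; toℕ; fromℕ; fromℕ<; punchIn; punchOut) renaming (_<_ to _<F_)
open import Data.Fin.Properties using (toℕ<n; toℕ-injective; toℕ-fromℕ<; 0≢1+n; punchInᵢ≢i; punchIn-injective; punchOut-punchIn; punchIn-punchOut) renaming (_≟_ to _≟F_; suc-injective to Fin-suc-injective)
open import Data.Vec using (Vec; []; _∷_; lookup; tabulate; updateAt; insertAt; removeAt; replicate)
import Data.Vec as Vec
import Data.Vec.Properties as Vec
open import Data.List using (List; []; _∷_; map; filter; length; foldr; upTo; cartesianProduct; _++_)
import Data.List as List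
import Data.List.Properties as List
open import Data.List.Relation.Unary.All using (universal)
open import Data.List.Membership.Propositional using (lose)
open import Data.List.Membership.Propositional.Properties using (∈-allFin)
open import Data.Maybe using (Maybe; just; nothing)
open import Data.Maybe.Properties using (just-injective)
open import Data.Product using (Σ; _×_; _,_; proj₁; proj₂)
open import Data.Sum using (_⊎_; inj₁; inj₂; [_,_]′)
open import Data.Unit using (⊤; tt)
open import Data.Empty using (⊥)
open import Function using (_∘_)
open import Relation.Binary.PropositionalEquality
open import Relation.Nullary using (¬_; Dec; yes; no; does; ¬?; contradiction)
open import Relation.Nullary.Decidable using (_×-dec_; _⊎-dec_; _→-dec_; decidable-stable; dec-true; dec-false)
open ≡-Reasoning

vec-ext : ∀ {A : Set} {n} {x y : Vec A n} → (∀ i → lookup x i ≡ lookup y i) → x ≡ y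
vec-ext {x = x} {y} eq = begin
  x                   ≡⟨ Vec.tabulate∘lookup x ⟨
  tabulate (lookup x) ≡⟨ Vec.tabulate-cong eq ⟩
  tabulate (lookup y) ≡⟨ Vec.tabulate∘lookup y ⟩
  y                   ∎

not-≢-self : ∀ b → not b ≢ b
not-≢-self false ()
not-≢-self true  ()

≢-≢⇒≡ : ∀ {a b c : Bool} → a ≢ c → b ≢ c → a ≡ b
≢-≢⇒≡ a≢c b≢c = trans (¬-not a≢c) (sym (¬-not b≢c))

xor-cancelʳ : ∀ {a b} c → a xor c ≡ b xor c → a ≡ b
xor-cancelʳ {false} {false} c eq = refl
xor-cancelʳ {true}  {true}  c eq = refl
xor-cancelʳ {false} {true}  false ()
xor-cancelʳ {false} {true}  true  ()
xor-cancelʳ {true}  {false} false ()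
xor-cancelʳ {true}  {false} true  ()

≡true⇔⇒≡ : ∀ {b c : Bool} → (b ≡ true → c ≡ true) → (c ≡ true → b ≡ true) → b ≡ c
≡true⇔⇒≡ {false} {false} _ _ = refl
≡true⇔⇒≡ {true}  {true}  _ _ = refl
≡true⇔⇒≡ {false} {true}  _ c→b = c→b refl
≡true⇔⇒≡ {true}  {false} b→c _ = sym (b→c refl)

lookup∘flipAt : ∀ {n} (x : Input n) i → lookup (flipAt x i) i ≡ not (lookup x i)
lookup∘flipAt x i = Vec.lookup∘updateAt i x

lookup∘flipAt′ : ∀ {n} (x : Input n) {i l} → l ≢ i → lookup (flipAt x i) l ≡ lookup x l
lookup∘flipAt′ x {i} {l} l≢i = Vec.lookup∘updateAt′ l i l≢i x

setAt : ∀ {n} → Input n → Fin n → Bool → Input n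
setAt x i v = updateAt x i (λ _ → v)

lookup∘setAt : ∀ {n} (x : Input n) i v → lookup (setAt x i v) i ≡ v
lookup∘setAt x i v = Vec.lookup∘updateAt i x

lookup∘setAt′ : ∀ {n} (x : Input n) {i l} v → l ≢ i → lookup (setAt x i v) l ≡ lookup x l
lookup∘setAt′ x {i} {l} v l≢i = Vec.lookup∘updateAt′ l i l≢i x

agree-off-inessential : ∀ {n} (f : Fun n) (S : Fin n → Set) → (∀ i → S i → ¬ Essential f i) →
  ∀ x y → (∀ i → ¬ S i → lookup x i ≡ lookup y i) → f x ≡ f y
agree-off-inessential {zero}  f S ness [] [] agree = refl
agree-off-inessential {suc n} f S ness (a ∷ x) (b ∷ y) agree = trans first rest
  where
  first : f (a ∷ x) ≡ f (b ∷ x)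
  first = decidable-stable (f (a ∷ x) ≟B f (b ∷ x)) λ ne →
    let a≢b : a ≢ b
        a≢b a≡b = ne (cong (λ c → f (c ∷ x)) a≡b)
        b≡¬a = ¬-not (a≢b ∘ sym)
        essential₀ : Essential f zero
        essential₀ = a ∷ x , λ e → ne (trans e (cong (λ c → f (c ∷ x)) (sym b≡¬a)))
    in a≢b (agree zero (λ s → ness zero s essential₀))
  rest : f (b ∷ x) ≡ f (b ∷ y)
  rest = agree-off-inessential (λ z → f (b ∷ z)) (S ∘ suc)
           (λ i s (z , ne) → ness (suc i) s (b ∷ z , ne)) x y (agree ∘ suc)

lookup-removeAt : ∀ {A : Set} {n} (x : Vec A (suc n)) j i → lookup (removeAt x j) i ≡ lookup x (punchIn j i)
lookup-removeAt x j i = begin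
  lookup (removeAt x j) i                        ≡⟨ cong (lookup (removeAt x j)) (punchOut-punchIn j) ⟨
  lookup (removeAt x j) (punchOut j≢punchIn)     ≡⟨ Vec.removeAt-punchOut x j≢punchIn ⟩
  lookup x (punchIn j i)                         ∎
  where
  j≢punchIn : j ≢ punchIn j i
  j≢punchIn = punchInᵢ≢i j i ∘ sym

removeAt-flipAt-punchIn : ∀ {n} (x : Input (suc n)) j i →
  removeAt (flipAt x (punchIn j i)) j ≡ flipAt (removeAt x j) i
removeAt-flipAt-punchIn x j i = vec-ext pointwise
  where
  pointwise : ∀ l → lookup (removeAt (flipAt x (punchIn j i)) j) l ≡ lookup (flipAt (removeAt x j) i) l
  pointwise l with l ≟F i
  ... | yes refl = begin
    lookup (removeAt (flipAt x (punchIn j l)) j) l ≡⟨ lookup-removeAt (flipAt x (punchIn j l)) j l ⟩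
    lookup (flipAt x (punchIn j l)) (punchIn j l)  ≡⟨ lookup∘flipAt x (punchIn j l) ⟩
    not (lookup x (punchIn j l))                   ≡⟨ cong not (lookup-removeAt x j l) ⟨
    not (lookup (removeAt x j) l)                  ≡⟨ lookup∘flipAt (removeAt x j) l ⟨
    lookup (flipAt (removeAt x j) l) l             ∎
  ... | no l≢i = begin
    lookup (removeAt (flipAt x (punchIn j i)) j) l ≡⟨ lookup-removeAt (flipAt x (punchIn j i)) j l ⟩
    lookup (flipAt x (punchIn j i)) (punchIn j l)  ≡⟨ lookup∘flipAt′ x (l≢i ∘ punchIn-injective j l i) ⟩
    lookup x (punchIn j l)                         ≡⟨ lookup-removeAt x j l ⟨
    lookup (removeAt x j) l                        ≡⟨ lookup∘flipAt′ (removeAt x j) l≢i ⟨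
    lookup (flipAt (removeAt x j) i) l             ∎

removeAt-flipAt-self : ∀ {n} (x : Input (suc n)) j → removeAt (flipAt x j) j ≡ removeAt x j
removeAt-flipAt-self x j = vec-ext λ l → begin
  lookup (removeAt (flipAt x j) j) l ≡⟨ lookup-removeAt (flipAt x j) j l ⟩
  lookup (flipAt x j) (punchIn j l)  ≡⟨ lookup∘flipAt′ x (punchInᵢ≢i j l) ⟩
  lookup x (punchIn j l)             ≡⟨ lookup-removeAt x j l ⟨
  lookup (removeAt x j) l            ∎

liftAt : ∀ {n} → Fin (suc n) → Fun n → Fun (suc n)
liftAt j g x = g (removeAt x j)

fixAt : ∀ {n} → Fin (suc n) → Fun (suc n) → Fun n
fixAt j f y = f (insertAt y j false)

fixAt-liftAt : ∀ {n} j (g : Fun n) y → fixAt j (liftAt j g) y ≡ g y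
fixAt-liftAt j g y = cong g (Vec.removeAt-insertAt y j false)

liftAt-fixAt : ∀ {n} j (f : Fun (suc n)) → ¬ Essential f j → ∀ x → liftAt j (fixAt j f) x ≡ f x
liftAt-fixAt j f ¬ess x = agree-off-inessential f (_≡ j) (λ { i refl → ¬ess }) x′ x agree
  where
  x′ = insertAt (removeAt x j) j false
  agree : ∀ l → l ≢ j → lookup x′ l ≡ lookup x l
  agree l l≢j = begin
    lookup x′ l                         ≡⟨ cong (lookup x′) (punchIn-punchOut j≢l) ⟨
    lookup x′ (punchIn j (punchOut j≢l)) ≡⟨ Vec.insertAt-punchIn (removeAt x j) j false (punchOut j≢l) ⟩
    lookup (removeAt x j) (punchOut j≢l) ≡⟨ lookup-removeAt x j (punchOut j≢l) ⟩
    lookup x (punchIn j (punchOut j≢l))  ≡⟨ cong (lookup x) (punchIn-punchOut j≢l) ⟩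
    lookup x l                          ∎
    where
    j≢l : j ≢ l
    j≢l = l≢j ∘ sym

-- Counting with indicator sums

indicator : ∀ {p} {P : Set p} → Dec P → ℕ
indicator (yes _) = 1
indicator (no _)  = 0

indicator-yes : ∀ {p} {P : Set p} (d : Dec P) → P → indicator d ≡ 1
indicator-yes (yes _) _ = refl
indicator-yes (no ¬p) p = contradiction p ¬p

indicator-no : ∀ {p} {P : Set p} (d : Dec P) → ¬ P → indicator d ≡ 0
indicator-no (yes p) ¬p = contradiction p ¬p
indicator-no (no _)  _  = refl

indicator-cong : ∀ {p q} {P : Set p} {Q : Set q} (d : Dec P) (e : Dec Q) → (P → Q) → (Q → P) →
  indicator d ≡ indicator e
indicator-cong (yes _) (yes _) _   _   = refl
indicator-cong (no _)  (no _)  _   _   = refl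
indicator-cong (yes p) (no ¬q) p→q _   = contradiction (p→q p) ¬q
indicator-cong (no ¬p) (yes q) _   q→p = contradiction (q→p q) ¬p

indicator-× : ∀ {p q} {P : Set p} {Q : Set q} (d : Dec P) (e : Dec Q) →
  indicator (d ×-dec e) ≡ indicator d * indicator e
indicator-× (yes _) (yes _) = refl
indicator-× (yes _) (no _)  = refl
indicator-× (no _)  _       = refl

indicator-mono : ∀ {p q} {P : Set p} {Q : Set q} (d : Dec P) (e : Dec Q) → (P → Q) → indicator d ≤ indicator e
indicator-mono (yes _) (yes _) _   = ℕ.≤-refl
indicator-mono (no _)  _       _   = z≤n
indicator-mono (yes p) (no ¬q) p→q = contradiction (p→q p) ¬q

indicator-⊎ : ∀ {p q} {P : Set p} {Q : Set q} (d : Dec P) (e : Dec Q) → ¬ (P × Q) →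
  indicator (d ⊎-dec e) ≡ indicator d + indicator e
indicator-⊎ (yes p) (yes q) disjoint = contradiction (p , q) disjoint
indicator-⊎ (yes _) (no _)  _        = refl
indicator-⊎ (no _)  (yes _) _        = refl
indicator-⊎ (no _)  (no _)  _        = refl

length-filter≡sum : ∀ {A : Set} {P : A → Set} (P? : ∀ a → Dec (P a)) xs →
  length (filter P? xs) ≡ sum (map (indicator ∘ P?) xs)
length-filter≡sum P? []       = refl
length-filter≡sum P? (x ∷ xs) with P? x
... | yes _ = cong suc (length-filter≡sum P? xs)
... | no  _ = length-filter≡sum P? xs

sum-map-cong : ∀ {A : Set} {g h : A → ℕ} → (∀ x → g x ≡ h x) → ∀ xs → sum (map g xs) ≡ sum (map h xs)
sum-map-cong g≗h xs = cong sum (List.map-cong g≗h xs)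

sum-map-+ : ∀ {A : Set} (g h : A → ℕ) xs → sum (map (λ x → g x + h x) xs) ≡ sum (map g xs) + sum (map h xs)
sum-map-+ g h []       = refl
sum-map-+ g h (x ∷ xs) = trans (cong (λ s → g x + h x + s) (sum-map-+ g h xs)) (interchange (g x) (h x) _ _)

sum-map-*ʳ : ∀ {A : Set} (g : A → ℕ) c xs → sum (map (λ x → g x * c) xs) ≡ sum (map g xs) * c
sum-map-*ʳ g c []       = refl
sum-map-*ʳ g c (x ∷ xs) = trans (cong (λ s → g x * c + s) (sum-map-*ʳ g c xs)) (sym (ℕ.*-distribʳ-+ c (g x) _))

sum-map-*ˡ : ∀ {A : Set} c (g : A → ℕ) xs → sum (map (λ x → c * g x) xs) ≡ c * sum (map g xs)
sum-map-*ˡ c g xs = begin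
  sum (map (λ x → c * g x) xs) ≡⟨ sum-map-cong (λ x → ℕ.*-comm c (g x)) xs ⟩
  sum (map (λ x → g x * c) xs) ≡⟨ sum-map-*ʳ g c xs ⟩
  sum (map g xs) * c           ≡⟨ ℕ.*-comm _ c ⟩
  c * sum (map g xs)           ∎

sum-map-zero : ∀ {A : Set} (xs : List A) → sum (map (λ _ → 0) xs) ≡ 0
sum-map-zero []       = refl
sum-map-zero (x ∷ xs) = sum-map-zero xs

sum-map-comm : ∀ {A B : Set} (h : A → B → ℕ) xs ys →
  sum (map (λ x → sum (map (h x) ys)) xs) ≡ sum (map (λ y → sum (map (λ x → h x y) xs)) ys)
sum-map-comm h []       ys = sym (sum-map-zero ys)
sum-map-comm h (x ∷ xs) ys = trans (cong (λ s → sum (map (h x) ys) + s) (sum-map-comm h xs ys))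
                                   (sym (sum-map-+ (h x) _ ys))

sum-map-cartesianProduct : ∀ {A B : Set} (g : A × B → ℕ) xs ys →
  sum (map g (cartesianProduct xs ys)) ≡ sum (map (λ x → sum (map (λ y → g (x , y)) ys)) xs)
sum-map-cartesianProduct g []       ys = refl
sum-map-cartesianProduct g (x ∷ xs) ys = begin
  sum (map g (map (x ,_) ys ++ cartesianProduct xs ys))
    ≡⟨ cong sum (List.map-++ g (map (x ,_) ys) _) ⟩
  sum (map g (map (x ,_) ys) ++ map g (cartesianProduct xs ys))
    ≡⟨ sum-++ (map g (map (x ,_) ys)) _ ⟩
  sum (map g (map (x ,_) ys)) + sum (map g (cartesianProduct xs ys))
    ≡⟨ cong₂ _+_ (cong sum (sym (List.map-∘ ys))) (sum-map-cartesianProduct g xs ys) ⟩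
  sum (map (λ y → g (x , y)) ys) + sum (map (λ x → sum (map (λ y → g (x , y)) ys)) xs) ∎

length-filter-none : ∀ {A : Set} {P : A → Set} (P? : ∀ a → Dec (P a)) → (∀ a → ¬ P a) → ∀ xs → length (filter P? xs) ≡ 0
length-filter-none P? ¬P xs = cong length (List.filter-none P? (universal ¬P xs))

filter-nonempty⇒witness : ∀ {A : Set} {P : A → Set} (P? : ∀ a → Dec (P a)) xs → 1 ≤ length (filter P? xs) → Σ A P
filter-nonempty⇒witness P? (x ∷ xs) nonempty with P? x
... | yes px = x , px
... | no _   = filter-nonempty⇒witness P? xs nonempty

sum-map-upTo-suc : ∀ (g : ℕ → ℕ) N → sum (map g (upTo (suc N))) ≡ sum (map g (upTo N)) + g N
sum-map-upTo-suc g N = begin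
  sum (map g (upTo (suc N)))               ≡⟨ cong (sum ∘ map g) (List.upTo-∷ʳ N) ⟨
  sum (map g (upTo N ++ N ∷ []))           ≡⟨ cong sum (List.map-++ g (upTo N) (N ∷ [])) ⟩
  sum (map g (upTo N) ++ g N ∷ [])         ≡⟨ sum-++ (map g (upTo N)) (g N ∷ []) ⟩
  sum (map g (upTo N)) + (g N + 0)         ≡⟨ cong (λ s → sum (map g (upTo N)) + s) (ℕ.+-identityʳ (g N)) ⟩
  sum (map g (upTo N)) + g N               ∎

sum-upTo-δ : ∀ a N → sum (map (λ i → indicator (a ≟ℕ i)) (upTo N)) ≡ indicator (a ℕ.<? N)
sum-upTo-δ a zero    = refl
sum-upTo-δ a (suc N) = begin
  sum (map δ (upTo (suc N)))                   ≡⟨ sum-map-upTo-suc δ N ⟩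
  sum (map δ (upTo N)) + δ N                   ≡⟨ cong (_+ δ N) (sum-upTo-δ a N) ⟩
  indicator (a ℕ.<? N) + indicator (a ≟ℕ N)    ≡⟨ indicator-⊎ (a ℕ.<? N) (a ≟ℕ N) (λ (a<N , a≡N) → ℕ.<⇒≢ a<N a≡N) ⟨
  indicator ((a ℕ.<? N) ⊎-dec (a ≟ℕ N))        ≡⟨ indicator-cong ((a ℕ.<? N) ⊎-dec (a ≟ℕ N)) (a ℕ.<? suc N)
                                                    [ ℕ.m<n⇒m<1+n , (λ { refl → ℕ.≤-refl }) ]′
                                                    ℕ.m<1+n⇒m<n∨m≡n ⟩
  indicator (a ℕ.<? suc N)                     ∎
  where
  δ = λ i → indicator (a ≟ℕ i)

length-filter-allFin : ∀ {n} {P : Fin n → Set} (P? : ∀ i → Dec (P i)) →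
  length (filter P? (List.allFin n)) ≡ ∑[ i < n ] indicator (P? i)
length-filter-allFin {n} P? = trans (length-filter≡sum P? (List.allFin n)) (go P? (λ i → i))
  where
  go : ∀ {m} {B : Set} {Q : B → Set} (Q? : ∀ b → Dec (Q b)) (h : Fin m → B) →
       sum (map (indicator ∘ Q?) (List.tabulate h)) ≡ ∑[ i < m ] indicator (Q? (h i))
  go {zero}  Q? h = refl
  go {suc m} Q? h = cong (λ s → indicator (Q? (h zero)) + s) (go Q? (h ∘ suc))

∑-sum-comm : ∀ {A : Set} {n} (h : Fin n → A → ℕ) xs →
  ∑[ j < n ] sum (map (h j) xs) ≡ sum (map (λ x → ∑[ j < n ] h j x) xs)
∑-sum-comm {n = zero}  h xs = sym (sum-map-zero xs)
∑-sum-comm {n = suc n} h xs = trans (cong (λ s → sum (map (h zero) xs) + s) (∑-sum-comm (h ∘ suc) xs))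
                                    (sym (sum-map-+ (h zero) _ xs))

∑-const : ∀ n c → ∑[ i < n ] c ≡ n * c
∑-const zero    c = refl
∑-const (suc n) c = cong (λ s → c + s) (∑-const n c)

∑-mono-≤ : ∀ {n} {g h : Fin n → ℕ} → (∀ i → g i ≤ h i) → ∑[ i < n ] g i ≤ ∑[ i < n ] h i
∑-mono-≤ {zero}  g≤h = z≤n
∑-mono-≤ {suc n} g≤h = ℕ.+-mono-≤ (g≤h zero) (∑-mono-≤ (g≤h ∘ suc))

∑-mono-< : ∀ {n} {g h : Fin n → ℕ} j → (∀ i → g i ≤ h i) → g j < h j → ∑[ i < n ] g i < ∑[ i < n ] h i
∑-mono-< {suc n} {g} {h} j g≤h gⱼ<hⱼ =
  subst₂ _<_ (sym (sum-remove g)) (sym (sum-remove h)) (ℕ.+-mono-<-≤ gⱼ<hⱼ (∑-mono-≤ (g≤h ∘ punchIn j)))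

tabulateBF : ∀ {n} → Fun n → BF n
tabulateBF {zero}  f = f []
tabulateBF {suc n} f = tabulateBF (λ x → f (false ∷ x)) , tabulateBF (λ x → f (true ∷ x))

eval-tabulateBF : ∀ {n} (f : Fun n) x → eval (tabulateBF f) x ≡ f x
eval-tabulateBF {zero}  f []          = refl
eval-tabulateBF {suc n} f (false ∷ x) = eval-tabulateBF (λ y → f (false ∷ y)) x
eval-tabulateBF {suc n} f (true  ∷ x) = eval-tabulateBF (λ y → f (true ∷ y)) x

eval-injective : ∀ {n} (F G : BF n) → (∀ x → eval F x ≡ eval G x) → F ≡ G
eval-injective {zero}  F G eq = eq []
eval-injective {suc n} (F₀ , F₁) (G₀ , G₁) eq =
  cong₂ _,_ (eval-injective F₀ G₀ (eq ∘ (false ∷_))) (eval-injective F₁ G₁ (eq ∘ (true ∷_)))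

_≟BF_ : ∀ {n} (F G : BF n) → Dec (F ≡ G)
_≟BF_ {zero}  F G = F ≟B G
_≟BF_ {suc n} (F₀ , F₁) (G₀ , G₁) with F₀ ≟BF G₀ | F₁ ≟BF G₁
... | yes refl | yes refl = yes refl
... | no F₀≢G₀ | _        = no (F₀≢G₀ ∘ cong proj₁)
... | yes _    | no F₁≢G₁ = no (F₁≢G₁ ∘ cong proj₂)

indicator-≟BF-pair : ∀ {n} (F₀ F₁ G₀ G₁ : BF n) →
  indicator ((F₀ , F₁) ≟BF (G₀ , G₁)) ≡ indicator (F₀ ≟BF G₀) * indicator (F₁ ≟BF G₁)
indicator-≟BF-pair F₀ F₁ G₀ G₁ = trans
  (indicator-cong ((F₀ , F₁) ≟BF (G₀ , G₁)) ((F₀ ≟BF G₀) ×-dec (F₁ ≟BF G₁))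
     (λ { refl → refl , refl }) (λ { (refl , refl) → refl }))
  (indicator-× (F₀ ≟BF G₀) (F₁ ≟BF G₁))

allBF-complete : ∀ n (G : BF n) → sum (map (λ F → indicator (F ≟BF G)) (allBF n)) ≡ 1
allBF-complete zero    false = refl
allBF-complete zero    true  = refl
allBF-complete (suc n) (G₀ , G₁) = begin
  sum (map (λ F → indicator (F ≟BF (G₀ , G₁))) (cartesianProduct (allBF n) (allBF n)))
    ≡⟨ sum-map-cartesianProduct _ (allBF n) (allBF n) ⟩
  sum (map (λ F₀ → sum (map (λ F₁ → indicator ((F₀ , F₁) ≟BF (G₀ , G₁))) (allBF n))) (allBF n))
    ≡⟨ sum-map-cong (λ F₀ → sum-map-cong (λ F₁ → indicator-≟BF-pair F₀ F₁ G₀ G₁) (allBF n)) (allBF n) ⟩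
  sum (map (λ F₀ → sum (map (λ F₁ → indicator (F₀ ≟BF G₀) * indicator (F₁ ≟BF G₁)) (allBF n))) (allBF n))
    ≡⟨ sum-map-cong (λ F₀ → sum-map-*ˡ (indicator (F₀ ≟BF G₀)) _ (allBF n)) (allBF n) ⟩
  sum (map (λ F₀ → indicator (F₀ ≟BF G₀) * sum (map (λ F₁ → indicator (F₁ ≟BF G₁)) (allBF n))) (allBF n))
    ≡⟨ sum-map-cong (λ F₀ → trans (cong (indicator (F₀ ≟BF G₀) *_) (allBF-complete n G₁)) (ℕ.*-identityʳ _)) (allBF n) ⟩
  sum (map (λ F₀ → indicator (F₀ ≟BF G₀)) (allBF n))
    ≡⟨ allBF-complete n G₀ ⟩
  1 ∎

sum-δ-allBF : ∀ {n} c (G : BF n) → sum (map (λ F → c * indicator (G ≟BF F)) (allBF n)) ≡ c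
sum-δ-allBF {n} c G = begin
  sum (map (λ F → c * indicator (G ≟BF F)) (allBF n))
    ≡⟨ sum-map-*ˡ c _ (allBF n) ⟩
  c * sum (map (λ F → indicator (G ≟BF F)) (allBF n))
    ≡⟨ cong (c *_) (sum-map-cong (λ F → indicator-cong (G ≟BF F) (F ≟BF G) sym sym) (allBF n)) ⟩
  c * sum (map (λ F → indicator (F ≟BF G)) (allBF n))
    ≡⟨ cong (c *_) (allBF-complete n G) ⟩
  c * 1
    ≡⟨ ℕ.*-identityʳ c ⟩
  c ∎

count-bijection : ∀ {a b} {P : BF a → Set} {Q : BF b → Set}
  (P? : ∀ F → Dec (P F)) (Q? : ∀ G → Dec (Q G)) (Φ : BF a → BF b) (Ψ : BF b → BF a) →
  (∀ F → P F → Q (Φ F)) → (∀ G → Q G → P (Ψ G)) →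
  (∀ F → P F → Ψ (Φ F) ≡ F) → (∀ G → Q G → Φ (Ψ G) ≡ G) →
  length (filter P? (allBF a)) ≡ length (filter Q? (allBF b))
count-bijection {a} {b} P? Q? Φ Ψ PQ QP ΨΦ ΦΨ = begin
  length (filter P? (allBF a))
    ≡⟨ length-filter≡sum P? (allBF a) ⟩
  sum (map (indicator ∘ P?) (allBF a))
    ≡⟨ sum-map-cong (λ F → sum-δ-allBF (indicator (P? F)) (Φ F)) (allBF a) ⟨
  sum (map (λ F → sum (map (λ G → indicator (P? F) * indicator (Φ F ≟BF G)) (allBF b))) (allBF a))
    ≡⟨ sum-map-comm _ (allBF a) (allBF b) ⟩
  sum (map (λ G → sum (map (λ F → indicator (P? F) * indicator (Φ F ≟BF G)) (allBF a))) (allBF b))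
    ≡⟨ sum-map-cong (λ G → sum-map-cong (λ F → pairs-correspond F G) (allBF a)) (allBF b) ⟩
  sum (map (λ G → sum (map (λ F → indicator (Q? G) * indicator (Ψ G ≟BF F)) (allBF a))) (allBF b))
    ≡⟨ sum-map-cong (λ G → sum-δ-allBF (indicator (Q? G)) (Ψ G)) (allBF b) ⟩
  sum (map (indicator ∘ Q?) (allBF b))
    ≡⟨ length-filter≡sum Q? (allBF b) ⟨
  length (filter Q? (allBF b)) ∎
  where
  pairs-correspond : ∀ F G → indicator (P? F) * indicator (Φ F ≟BF G) ≡ indicator (Q? G) * indicator (Ψ G ≟BF F)
  pairs-correspond F G = begin
    indicator (P? F) * indicator (Φ F ≟BF G)   ≡⟨ indicator-× (P? F) (Φ F ≟BF G) ⟨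
    indicator (P? F ×-dec (Φ F ≟BF G))         ≡⟨ indicator-cong (P? F ×-dec (Φ F ≟BF G)) (Q? G ×-dec (Ψ G ≟BF F))
                                                   (λ { (p , refl) → PQ F p , ΨΦ F p })
                                                   (λ { (q , refl) → QP G q , ΦΨ G q }) ⟩
    indicator (Q? G ×-dec (Ψ G ≟BF F))         ≡⟨ indicator-× (Q? G) (Ψ G ≟BF F) ⟩
    indicator (Q? G) * indicator (Ψ G ≟BF F)   ∎

-- Canalizing chains

Region : ℕ → Set
Region n = List (Fin n × Bool)

Inside : ∀ {n} → Region n → Input n → Set
Inside []            x = ⊤
Inside ((i , c) ∷ R) x = lookup x i ≢ c × Inside R x

Fresh : ∀ {n} → Region n → Fin n → Set
Fresh []            i = ⊤
Fresh ((j , c) ∷ R) i = j ≢ i × Fresh R i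

inside? : ∀ {n} (R : Region n) x → Dec (Inside R x)
inside? []            x = yes tt
inside? ((i , c) ∷ R) x = ¬? (lookup x i ≟B c) ×-dec inside? R x

fresh? : ∀ {n} (R : Region n) i → Dec (Fresh R i)
fresh? []            i = yes tt
fresh? ((j , c) ∷ R) i = ¬? (j ≟F i) ×-dec fresh? R i

CanalizingStep : ∀ {n} → Fun n → Region n → Fin n → Bool → Bool → Set
CanalizingStep {n} f R i c d =
  Fresh R i × (∀ x → Inside R x → lookup x i ≡ c → f x ≡ d) ×
  Σ (Input n) λ x → Inside R x × lookup x i ≢ c × f x ≢ d

CanalizingIn : ∀ {n} → Fun n → Region n → Set
CanalizingIn {n} f R = Σ (Fin n) λ i → Σ Bool λ c → Σ Bool λ d → CanalizingStep f R i c d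

canalizingIn? : ∀ {n} (f : Fun n) R → Dec (CanalizingIn f R)
canalizingIn? {n} f R = searchFin _ λ i → searchBool _ λ c → searchBool _ λ d →
  fresh? R i ×-dec
  searchAll (searchInput n) _ (λ x → inside? R x →-dec ((lookup x i ≟B c) →-dec (f x ≟B d))) ×-dec
  searchInput n _ (λ x → inside? R x ×-dec (¬? (lookup x i ≟B c) ×-dec ¬? (f x ≟B d)))

-- One maximal chain of canalizing steps starting in region R; by depth-unique all such chains
-- have the same length.
data Depth {n} (f : Fun n) : Region n → ℕ → Set where
  stop : ∀ {R} → ¬ CanalizingIn f R → Depth f R 0
  step : ∀ {R i c d k} → CanalizingStep f R i c d → Depth f ((i , c) ∷ R) k → Depth f R (suc k)

inside-updateAt : ∀ {n} (R : Region n) x i (g : Bool → Bool) → Fresh R i → Inside R x → Inside R (updateAt x i g)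
inside-updateAt []            x i g fresh inside = tt
inside-updateAt ((j , c) ∷ R) x i g (j≢i , fresh) (xⱼ≢c , inside) =
  (λ e → xⱼ≢c (trans (sym (Vec.lookup∘updateAt′ j i j≢i x)) e)) , inside-updateAt R x i g fresh inside

step-essential : ∀ {n} {f : Fun n} {R i c d} → CanalizingStep f R i c d → Essential f i
step-essential {f = f} {R} {i} (fresh , canalizes , x , inside , xᵢ≢c , fx≢d) =
  x , λ e → fx≢d (trans e (canalizes (flipAt x i) (inside-updateAt R x i not fresh inside)
                            (trans (lookup∘flipAt x i) (sym (¬-not (xᵢ≢c ∘ sym))))))

step-swap : ∀ {n} {f : Fun n} {R i c d i′ c′ d′} → CanalizingStep f R i c d → CanalizingStep f R i′ c′ d′ → i ≢ i′ →
  CanalizingStep f ((i , c) ∷ R) i′ c′ d′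
step-swap {f = f} {R} {i} {c} {d} {i′} {c′} {d′}
  (fresh , canalizes , x₀ , x₀-inside , _) (fresh′ , canalizes′ , x , x-inside , xᵢ′≢c′ , fx≢d′) i≢i′ =
  (i≢i′ , fresh′) , (λ y y-inside → canalizes′ y (proj₂ y-inside)) , x , (xᵢ≢c , x-inside) , xᵢ′≢c′ , fx≢d′
  where
  y = setAt (setAt x₀ i c) i′ c′
  d≡d′ : d ≡ d′
  d≡d′ = trans (sym (canalizes y (inside-updateAt R _ i′ _ fresh′ (inside-updateAt R x₀ i _ fresh x₀-inside))
                       (trans (lookup∘setAt′ (setAt x₀ i c) c′ i≢i′) (lookup∘setAt x₀ i c))))
               (canalizes′ y (inside-updateAt R _ i′ _ fresh′ (inside-updateAt R x₀ i _ fresh x₀-inside))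
                       (lookup∘setAt (setAt x₀ i c) i′ c′))
  xᵢ≢c : lookup x i ≢ c
  xᵢ≢c xᵢ≡c = fx≢d′ (trans (canalizes x x-inside xᵢ≡c) d≡d′)

step-opposite : ∀ {n} {f : Fun n} {R i c d c′ d′} → CanalizingStep f R i c d → CanalizingStep f R i c′ d′ → c ≢ c′ →
  ¬ CanalizingIn f ((i , c) ∷ R)
step-opposite {f = f} {R} {i} {c} {d} {c′} {d′} _ (_ , canalizes′ , _) c≢c′
  (i″ , c″ , d″ , (i≢i″ , fresh″) , canalizes″ , w , (wᵢ≢c , w-inside) , _ , fw≢d″) =
  fw≢d″ (trans (value-d′ w w-inside wᵢ≢c) (trans (sym (value-d′ y y-inside yᵢ≢c)) fy≡d″))
  where
  value-d′ : ∀ x → Inside R x → lookup x i ≢ c → f x ≡ d′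
  value-d′ x inside xᵢ≢c = canalizes′ x inside (≢-≢⇒≡ xᵢ≢c (c≢c′ ∘ sym))
  y = setAt w i″ c″
  y-inside = inside-updateAt R w i″ _ fresh″ w-inside
  yᵢ≢c : lookup y i ≢ c
  yᵢ≢c = wᵢ≢c ∘ trans (sym (lookup∘setAt′ w c″ i≢i″))
  fy≡d″ : f y ≡ d″
  fy≡d″ = canalizes″ y (yᵢ≢c , y-inside) (lookup∘setAt w i″ c″)

_≈ᴿ_ : ∀ {n} → Region n → Region n → Set
R ≈ᴿ R′ = (∀ x → Inside R x → Inside R′ x) × (∀ x → Inside R′ x → Inside R x) ×
          (∀ i → Fresh R i → Fresh R′ i) × (∀ i → Fresh R′ i → Fresh R i)

≈ᴿ-sym : ∀ {n} {R R′ : Region n} → R ≈ᴿ R′ → R′ ≈ᴿ R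
≈ᴿ-sym (⊆ , ⊇ , fresh⊆ , fresh⊇) = ⊇ , ⊆ , fresh⊇ , fresh⊆

≈ᴿ-cons : ∀ {n} {R R′ : Region n} i c → R ≈ᴿ R′ → ((i , c) ∷ R) ≈ᴿ ((i , c) ∷ R′)
≈ᴿ-cons i c (⊆ , ⊇ , fresh⊆ , fresh⊇) =
  (λ x (h , r) → h , ⊆ x r) , (λ x (h , r) → h , ⊇ x r) ,
  (λ l (h , r) → h , fresh⊆ l r) , (λ l (h , r) → h , fresh⊇ l r)

≈ᴿ-swap : ∀ {n} (R : Region n) i c i′ c′ → ((i , c) ∷ (i′ , c′) ∷ R) ≈ᴿ ((i′ , c′) ∷ (i , c) ∷ R)
≈ᴿ-swap R i c i′ c′ =
  (λ _ (a , b , r) → b , a , r) , (λ _ (a , b , r) → b , a , r) ,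
  (λ _ (a , b , r) → b , a , r) , (λ _ (a , b , r) → b , a , r)

step-resp-≈ᴿ : ∀ {n} {f : Fun n} {R R′ i c d} → R ≈ᴿ R′ → CanalizingStep f R i c d → CanalizingStep f R′ i c d
step-resp-≈ᴿ (⊆ , ⊇ , fresh⊆ , _) (fresh , canalizes , x , inside , rest) =
  fresh⊆ _ fresh , (λ y → canalizes y ∘ ⊇ y) , x , ⊆ x inside , rest

depth-resp-≈ᴿ : ∀ {n} {f : Fun n} {R R′ k} → R ≈ᴿ R′ → Depth f R k → Depth f R′ k
depth-resp-≈ᴿ R≈R′ (stop ¬can) = stop λ (i , c , d , st) → ¬can (i , c , d , step-resp-≈ᴿ (≈ᴿ-sym R≈R′) st)
depth-resp-≈ᴿ R≈R′ (step {i = i} {c} st D) = step (step-resp-≈ᴿ R≈R′ st) (depth-resp-≈ᴿ (≈ᴿ-cons i c R≈R′) D)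

essentialFresh : ∀ {n} → Fun n → Region n → ℕ
essentialFresh {n} f R = ∑[ i < n ] indicator (essential? f i ×-dec fresh? R i)

essentialFresh-step : ∀ {n} {f : Fun n} {R i c d} → CanalizingStep f R i c d →
  essentialFresh f ((i , c) ∷ R) < essentialFresh f R
essentialFresh-step {f = f} {R} {i} {c} st = ∑-mono-< i
  (λ l → indicator-mono (essential? f l ×-dec fresh? ((i , c) ∷ R) l) (essential? f l ×-dec fresh? R l)
           (λ (ess , _ , fresh) → ess , fresh))
  (subst₂ _<_ (sym (indicator-no (essential? f i ×-dec fresh? ((i , c) ∷ R) i) (λ (_ , i≢i , _) → i≢i refl)))
              (sym (indicator-yes (essential? f i ×-dec fresh? R i) (step-essential st , proj₁ st)))
              (s≤s z≤n))

depth≤essentialFresh : ∀ {n} {f : Fun n} {R k} → Depth f R k → k ≤ essentialFresh f R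
depth≤essentialFresh (stop _)    = z≤n
depth≤essentialFresh (step st D) = ℕ.≤-trans (s≤s (depth≤essentialFresh D)) (essentialFresh-step st)

depth-exists : ∀ {n} (f : Fun n) (R : Region n) → Σ ℕ (Depth f R)
depth-exists f R = go (essentialFresh f R) R ℕ.≤-refl
  where
  go : ∀ fuel R → essentialFresh f R ≤ fuel → Σ ℕ (Depth f R)
  go fuel R bound with canalizingIn? f R
  ... | no ¬can = 0 , stop ¬can
  go zero       R bound | yes (i , c , d , st) = contradiction (ℕ.<-≤-trans (essentialFresh-step st) bound) ℕ.n≮0
  go (suc fuel) R bound | yes (i , c , d , st) =
    let k , D = go fuel ((i , c) ∷ R) (ℕ.≤-pred (ℕ.<-≤-trans (essentialFresh-step st) bound)) in suc k , step st D

depth-zero : ∀ {n} {f : Fun n} {R k} → ¬ CanalizingIn f R → Depth f R k → k ≡ 0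
depth-zero ¬can (stop _)                    = refl
depth-zero ¬can (step {i = i} {c} {d} st _) = contradiction (i , c , d , st) ¬can

depth-unique : ∀ {n} {f : Fun n} {R} k {k′} → Depth f R k → Depth f R k′ → k ≡ k′
depth-unique zero (stop ¬can) D′ = sym (depth-zero ¬can D′)
depth-unique (suc k) (step {i = i} {c} {d} st D) (stop ¬can) = contradiction (i , c , d , st) ¬can
depth-unique {f = f} {R} (suc k) (step {i = i} {c} st D) (step {i = i′} {c′} st′ D′) with i ≟F i′ | c ≟B c′
... | yes refl | yes refl = cong suc (depth-unique k D D′)
... | yes refl | no c≢c′  = cong suc (trans (depth-zero (step-opposite st st′ c≢c′) D)
                                            (sym (depth-zero (step-opposite st′ st (c≢c′ ∘ sym)) D′)))
... | no i≢i′  | _        = cong suc (depth-unique k (subst (Depth f ((i′ , c′) ∷ R)) (sym k≡) via-i′-then-i) D′)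
  where
  -- Both steps remain available after the other one: a diamond.
  rest = depth-exists f ((i′ , c′) ∷ (i , c) ∷ R)
  k≡ : k ≡ suc (proj₁ rest)
  k≡ = depth-unique k D (step (step-swap st st′ i≢i′) (proj₂ rest))
  via-i′-then-i : Depth f ((i′ , c′) ∷ R) (suc (proj₁ rest))
  via-i′-then-i = step (step-swap st′ st (i≢i′ ∘ sym)) (depth-resp-≈ᴿ (≈ᴿ-swap R i′ c′ i c) (proj₂ rest))

depth-after-step : ∀ {n} {f : Fun n} {R i c d k} → CanalizingStep f R i c d → Depth f R (suc k) →
  Depth f ((i , c) ∷ R) k
depth-after-step {f = f} {R} {i} {c} {k = k} st D =
  subst (Depth f ((i , c) ∷ R)) (sym (ℕ.suc-injective (depth-unique (suc k) D (step st (proj₂ rest))))) (proj₂ rest)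
  where
  rest = depth-exists f ((i , c) ∷ R)

extend : ∀ {n m} → Region n → Vec (Fin n) m → Vec Bool m → Region n
extend R []      []      = R
extend R (s ∷ σ) (c ∷ a) = extend ((s , c) ∷ R) σ a

inside-extend⁻ : ∀ {n m} (R : Region n) (σ : Vec (Fin n) m) a x → Inside (extend R σ a) x → Inside R x × Avoids σ a x
inside-extend⁻ R []      []      x inside = inside , λ ()
inside-extend⁻ R (s ∷ σ) (c ∷ a) x inside with inside-extend⁻ ((s , c) ∷ R) σ a x inside
... | (xₛ≢c , inside′) , avoids = inside′ , λ { zero → xₛ≢c ; (suc l) → avoids l }

inside-extend⁺ : ∀ {n m} (R : Region n) (σ : Vec (Fin n) m) a x → Inside R x → Avoids σ a x → Inside (extend R σ a) x
inside-extend⁺ R []      []      x inside avoids = inside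
inside-extend⁺ R (s ∷ σ) (c ∷ a) x inside avoids =
  inside-extend⁺ ((s , c) ∷ R) σ a x (avoids zero , inside) (avoids ∘ suc)

fresh-extend⁻ : ∀ {n m} (R : Region n) (σ : Vec (Fin n) m) a i →
  Fresh (extend R σ a) i → Fresh R i × (∀ l → lookup σ l ≢ i)
fresh-extend⁻ R []      []      i fresh = fresh , λ ()
fresh-extend⁻ R (s ∷ σ) (c ∷ a) i fresh with fresh-extend⁻ ((s , c) ∷ R) σ a i fresh
... | (s≢i , fresh′) , avoids = fresh′ , λ { zero → s≢i ; (suc l) → avoids l }

record CanalizingChain {n k} (f : Fun n) (R : Region n)
       (σ : Vec (Fin n) (suc k)) (a b : Vec Bool (suc k)) : Set where
  field
    canalizes : ∀ (j : Fin (suc k)) (x : Input n) → Inside R x →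
                (∀ l → l <F j → lookup x (lookup σ l) ≢ lookup a l) →
                lookup x (lookup σ j) ≡ lookup a j → f x ≡ lookup b j
    x : Input n
    x-inside : Inside R x
    x-avoids : Avoids σ a x
    fx≢last : f x ≢ lookup b (fromℕ k)
    distinct : Distinct σ
    fresh : ∀ l → Fresh R (lookup σ l)

chain-head : ∀ {n k} {f : Fun n} {R s σ c a d b} →
  CanalizingChain {k = k} f R (s ∷ σ) (c ∷ a) (d ∷ b) → CanalizingStep f R s c d
chain-head {k = zero} chain =
  fresh zero , (λ y y-inside → canalizes zero y y-inside (λ _ ())) , x , x-inside , x-avoids zero , fx≢last
  where open CanalizingChain chain
chain-head {k = suc k} {f} {R} {s} {σ} {c} {a} {d} {b} chain =
  fresh zero , (λ y y-inside → canalizes zero y y-inside (λ _ ())) , witness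
  where
  open CanalizingChain chain
  last = fromℕ (suc k)
  witness : Σ (Input _) λ y → Inside R y × lookup y s ≢ c × f y ≢ d
  witness with f x ≟B d
  ... | no fx≢d = x , x-inside , x-avoids zero , fx≢d
  ... | yes fx≡d = y , inside-updateAt R x _ _ (fresh last) x-inside , yₛ≢c ,
                   λ fy≡d → fx≢last (trans fx≡d (trans (sym fy≡d) fy≡last))
    where
    -- Moving x onto the last canalizing input makes f take the last output, which f x avoids.
    y = setAt x (lookup (s ∷ σ) last) (lookup (c ∷ a) last)
    agrees-before-last : ∀ l → l <F last → lookup y (lookup (s ∷ σ) l) ≡ lookup x (lookup (s ∷ σ) l)
    agrees-before-last l l<last = lookup∘setAt′ x _ λ e → ℕ.<-irrefl (cong toℕ (distinct l last e)) l<last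
    yₛ≢c : lookup y s ≢ c
    yₛ≢c = x-avoids zero ∘ trans (sym (agrees-before-last zero (s≤s z≤n)))
    fy≡last : f y ≡ lookup (d ∷ b) last
    fy≡last = canalizes last y (inside-updateAt R x _ _ (fresh last) x-inside)
      (λ l l<last → x-avoids l ∘ trans (sym (agrees-before-last l l<last))) (lookup∘setAt x _ _)

chain-tail : ∀ {n k} {f : Fun n} {R s σ c a d b} →
  CanalizingChain {k = suc k} f R (s ∷ σ) (c ∷ a) (d ∷ b) → CanalizingChain {k = k} f ((s , c) ∷ R) σ a b
chain-tail chain = record
  { canalizes = λ j y (yₛ≢c , inside′) before yⱼ≡aⱼ → canalizes (suc j) y inside′
                  (λ { zero _ → yₛ≢c ; (suc l) (s≤s l<j) → before l l<j }) yⱼ≡aⱼ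
  ; x = x
  ; x-inside = x-avoids zero , x-inside
  ; x-avoids = x-avoids ∘ suc
  ; fx≢last = fx≢last
  ; distinct = λ i j e → Fin-suc-injective (distinct (suc i) (suc j) e)
  ; fresh = λ l → (λ e → 0≢1+n (distinct zero (suc l) e)) , fresh (suc l)
  }
  where open CanalizingChain chain

chain-depth : ∀ {n k} {f : Fun n} {R σ a b} → CanalizingChain {k = k} f R σ a b →
  ¬ CanalizingIn f (extend R σ a) → Depth f R (suc k)
chain-depth {k = zero}  {σ = _ ∷ []} {_ ∷ []} {_ ∷ []} chain ¬can = step (chain-head chain) (stop ¬can)
chain-depth {k = suc k} {σ = _ ∷ _ ∷ _} {_ ∷ _ ∷ _} {_ ∷ _ ∷ _} chain ¬can =
  step (chain-head chain) (chain-depth (chain-tail chain) ¬can)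

chain-essential : ∀ {n k} {f : Fun n} {R σ a b} → CanalizingChain {k = k} f R σ a b →
  ∀ l → Essential f (lookup σ l)
chain-essential {σ = _ ∷ _} {_ ∷ _} {_ ∷ _} chain zero = step-essential (chain-head chain)
chain-essential {k = suc k} {σ = _ ∷ _ ∷ _} {_ ∷ _ ∷ _} {_ ∷ _ ∷ _} chain (suc l) =
  chain-essential (chain-tail chain) l

kCanalizing⇒chain : ∀ {n k} {f : Fun n} {σ a b} → KCanalizing {n} {k} f σ a b → Distinct σ →
  CanalizingChain f [] σ a b
kCanalizing⇒chain (canalizes , (x , avoids , fx≢last)) distinct = record
  { canalizes = λ j y _ → canalizes j y
  ; x = x
  ; x-inside = tt
  ; x-avoids = avoids
  ; fx≢last = fx≢last
  ; distinct = distinct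
  ; fresh = λ _ → tt
  }

kCanalizing-essential : ∀ {n k} {f : Fun n} σ a b → KCanalizing {n} {k} f σ a b → Distinct σ →
  ∀ l → Essential f (lookup σ l)
kCanalizing-essential σ a b kcan distinct = chain-essential (kCanalizing⇒chain {σ = σ} {a} {b} kcan distinct)

canalizingIn⇒canalizingOn : ∀ {n m} {f : Fun n} (σ : Vec (Fin n) m) a →
  CanalizingIn f (extend [] σ a) → CanalizingOn σ a f
canalizingIn⇒canalizingOn σ a (i , c , d , fresh , canalizes , w , inside , wᵢ≢c , fw≢d) =
  i , proj₂ (fresh-extend⁻ [] σ a i fresh) , c , d ,
  (λ x avoids → canalizes x (inside-extend⁺ [] σ a x tt avoids)) ,
  w , proj₂ (inside-extend⁻ [] σ a w inside) , wᵢ≢c , fw≢d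

hasDepth⇒depth : ∀ {n} {f : Fun n} k → HasDepth f k → Depth f [] k
hasDepth⇒depth zero    ¬can = stop (¬can ∘ canalizingIn⇒canalizingOn [] [])
hasDepth⇒depth (suc k) (σ , distinct , a , b , kcan , ¬can) =
  chain-depth (kCanalizing⇒chain {σ = σ} {a} {b} kcan distinct) (¬can ∘ canalizingIn⇒canalizingOn σ a)

numEssential≡∑ : ∀ {n} (f : Fun n) → numEssential f ≡ ∑[ i < n ] indicator (essential? f i)
numEssential≡∑ f = length-filter-allFin (essential? f)

depth≤numEssential : ∀ {n} {f : Fun n} k → HasDepth f k → k ≤ numEssential f
depth≤numEssential {f = f} k hasDepth = subst (k ≤_) essentialFresh[]≡ (depth≤essentialFresh (hasDepth⇒depth k hasDepth))
  where
  essentialFresh[]≡ : essentialFresh f [] ≡ numEssential f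
  essentialFresh[]≡ = sym (trans (numEssential≡∑ f) (sum-cong-≗ λ i →
    indicator-cong (essential? f i) (essential? f i ×-dec fresh? [] i) (_, tt) proj₁))

-- Layer representations

nestFin : ∀ r → (Fin r → Bool) → Bool → Bool
nestFin zero          m p = p
nestFin (suc zero)    m p = m zero ∧ p
nestFin (suc (suc r)) m p = m zero ∧ not (nestFin (suc r) (m ∘ suc) p)

nest-tabulate : ∀ r (m : Fin r → Bool) p → nest (List.tabulate m) p ≡ nestFin r m p
nest-tabulate zero          m p = refl
nest-tabulate (suc zero)    m p = refl
nest-tabulate (suc (suc r)) m p = cong (λ v → m zero ∧ not v) (nest-tabulate (suc r) (m ∘ suc) p)

nestFin-cong : ∀ r {m m′ : Fin r → Bool} {p p′} → (∀ i → m i ≡ m′ i) → p ≡ p′ → nestFin r m p ≡ nestFin r m′ p′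
nestFin-cong zero          m≗m′ p≡p′ = p≡p′
nestFin-cong (suc zero)    m≗m′ p≡p′ = cong₂ _∧_ (m≗m′ zero) p≡p′
nestFin-cong (suc (suc r)) m≗m′ p≡p′ = cong₂ (λ u v → u ∧ not v) (m≗m′ zero) (nestFin-cong (suc r) (m≗m′ ∘ suc) p≡p′)

not^ : ℕ → Bool → Bool
not^ zero    b = b
not^ (suc t) b = not (not^ t b)

not^-injective : ∀ t {b b′} → not^ t b ≡ not^ t b′ → b ≡ b′
not^-injective zero    e = e
not^-injective (suc t) e = not^-injective t (not-injective e)

not^-true≢false : ∀ t → not^ t true ≢ not^ t false
not^-true≢false t e with not^-injective t e
... | ()

nestFin-first-false : ∀ r (m : Fin r → Bool) p t → t < r →
  (∀ i → toℕ i < t → m i ≡ true) → (∀ i → toℕ i ≡ t → m i ≡ false) → nestFin r m p ≡ not^ t false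
nestFin-first-false (suc zero)    m p zero    _ _ false-at rewrite false-at zero refl = refl
nestFin-first-false (suc (suc r)) m p zero    _ _ false-at rewrite false-at zero refl = refl
nestFin-first-false (suc zero)    m p (suc t) (s≤s ())
nestFin-first-false (suc (suc r)) m p (suc t) (s≤s t<r) true-before false-at rewrite true-before zero (s≤s z≤n) =
  cong not (nestFin-first-false (suc r) (m ∘ suc) p t t<r (λ i → true-before (suc i) ∘ s≤s) (λ i → false-at (suc i) ∘ cong suc))

nestFin-true-upto : ∀ r (m : Fin r → Bool) p t → t < r →
  (∀ i → toℕ i ≤ t → m i ≡ true) → (∀ i → toℕ i ≡ suc t → m i ≡ false) → (suc t ≡ r → p ≡ true) →
  nestFin r m p ≡ not^ t true
nestFin-true-upto (suc zero)    m p zero    _ true-upto _ p-true rewrite true-upto zero z≤n | p-true refl = refl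
nestFin-true-upto (suc zero)    m p (suc t) (s≤s ())
nestFin-true-upto (suc (suc r)) m p zero    _ true-upto false-at _ rewrite true-upto zero z≤n =
  cong not (nestFin-first-false (suc r) (m ∘ suc) p zero (s≤s z≤n) (λ _ ()) (λ i → false-at (suc i) ∘ cong suc))
nestFin-true-upto (suc (suc r)) m p (suc t) (s≤s t<r) true-upto false-at p-true rewrite true-upto zero z≤n =
  cong not (nestFin-true-upto (suc r) (m ∘ suc) p t t<r (λ i → true-upto (suc i) ∘ s≤s)
                              (λ i → false-at (suc i) ∘ cong suc) (p-true ∘ cong suc))

nestFin-all-true : ∀ r (m : Fin r → Bool) p → (∀ i → m i ≡ true) → nestFin r m p ≡ not^ (pred r) p
nestFin-all-true zero          m p all-true = refl
nestFin-all-true (suc zero)    m p all-true = cong (_∧ p) (all-true zero)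
nestFin-all-true (suc (suc r)) m p all-true =
  cong₂ (λ u v → u ∧ not v) (all-true zero) (nestFin-all-true (suc r) (m ∘ suc) p (all-true ∘ suc))

and-tabulate-true : ∀ {n} (g : Fin n → Bool) → (∀ j → g j ≡ true) → foldr _∧_ true (List.tabulate g) ≡ true
and-tabulate-true {zero}  g all-true = refl
and-tabulate-true {suc n} g all-true rewrite all-true zero = and-tabulate-true (g ∘ suc) (all-true ∘ suc)

and-tabulate-false : ∀ {n} (g : Fin n → Bool) j → g j ≡ false → foldr _∧_ true (List.tabulate g) ≡ false
and-tabulate-false {suc n} g zero    gⱼ≡false rewrite gⱼ≡false = refl
and-tabulate-false {suc n} g (suc j) gⱼ≡false with g zero
... | true  = and-tabulate-false (g ∘ suc) j gⱼ≡false
... | false = refl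

module _ {n r} (ρ : Rep n r) where

  private
    factor : Fin r → Input n → Fin n → Bool
    factor i x j = if does (inLayer? ρ i j) then lookup x j xor lookup (sign ρ) j else true

    monomial≡and : ∀ i x → monomial ρ i x ≡ foldr _∧_ true (List.tabulate (factor i x))
    monomial≡and i x = cong (foldr _∧_ true) (List.map-tabulate (λ j → j) (factor i x))

  monomial-true : ∀ i x → (∀ j → InLayer ρ i j → lookup x j ≢ lookup (sign ρ) j) → monomial ρ i x ≡ true
  monomial-true i x differs = trans (monomial≡and i x) (and-tabulate-true (factor i x) factor-true)
    where
    factor-true : ∀ j → factor i x j ≡ true
    factor-true j with inLayer? ρ i j
    ... | yes j∈i = xor-≢ (differs j j∈i)
      where
      xor-≢ : ∀ {u v} → u ≢ v → u xor v ≡ true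
      xor-≢ {false} {false} u≢v = contradiction refl u≢v
      xor-≢ {false} {true}  _   = refl
      xor-≢ {true}  {false} _   = refl
      xor-≢ {true}  {true}  u≢v = contradiction refl u≢v
    ... | no _ = refl

  monomial-false : ∀ i x j → InLayer ρ i j → lookup x j ≡ lookup (sign ρ) j → monomial ρ i x ≡ false
  monomial-false i x j j∈i xⱼ≡sⱼ = trans (monomial≡and i x) (and-tabulate-false (factor i x) j factor-false)
    where
    factor-false : factor i x j ≡ false
    factor-false with inLayer? ρ i j
    ... | yes _   = trans (cong (_xor lookup (sign ρ) j) xⱼ≡sⱼ) (xor-same (lookup (sign ρ) j))
    ... | no j∉i = contradiction j∈i j∉i

  monomial-true⁻ : ∀ i x → monomial ρ i x ≡ true → ∀ j → InLayer ρ i j → lookup x j ≢ lookup (sign ρ) j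
  monomial-true⁻ i x M≡true j j∈i xⱼ≡sⱼ with trans (sym M≡true) (monomial-false i x j j∈i xⱼ≡sⱼ)
  ... | ()

  repEval≡nestFin : ∀ x → repEval ρ x ≡ nestFin r (λ i → monomial ρ i x) (eval (core ρ) x) xor qconst ρ
  repEval≡nestFin x = cong (_xor qconst ρ) (begin
    nest (map (λ i → monomial ρ i x) (List.allFin r)) (eval (core ρ) x)
      ≡⟨ cong (λ ms → nest ms (eval (core ρ) x)) (List.map-tabulate (λ i → i) (λ i → monomial ρ i x)) ⟩
    nest (List.tabulate (λ i → monomial ρ i x)) (eval (core ρ) x)
      ≡⟨ nest-tabulate r _ _ ⟩
    nestFin r (λ i → monomial ρ i x) (eval (core ρ) x) ∎)

module Represented {n r} (ρ : Rep n r) (valid : ValidRep ρ) (f : Fun n) (f≗ρ : ∀ x → f x ≡ repEval ρ x) where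

  L = layer ρ
  s = sign ρ
  p = eval (core ρ)
  q = qconst ρ

  value : Input n → Bool
  value x = nestFin r (λ i → monomial ρ i x) (p x)

  f≡value : ∀ x → f x ≡ value x xor q
  f≡value x = trans (f≗ρ x) (repEval≡nestFin ρ x)

  layer-nonempty : ∀ i → Σ (Fin n) (InLayer ρ i)
  layer-nonempty i = filter-nonempty⇒witness (inLayer? ρ i) (List.allFin n) (proj₁ valid i)

  core-agree : ∀ x y → (∀ j → lookup L j ≡ nothing → lookup x j ≡ lookup y j) → p x ≡ p y
  core-agree x y agree = agree-off-inessential p (λ j → lookup L j ≢ nothing) (proj₁ (proj₂ valid)) x y
    λ j ¬layered → agree j (core-variable ¬layered)
    where
    core-variable : ∀ {m : Maybe (Fin r)} → ¬ m ≢ nothing → m ≡ nothing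
    core-variable {nothing} _        = refl
    core-variable {just _}  ¬layered = contradiction (λ ()) ¬layered

  assignEntry : (Fin r → Bool) → Maybe (Fin r) → Bool → Bool → Bool
  assignEntry P (just i) sⱼ yⱼ = if P i then not sⱼ else sⱼ
  assignEntry P nothing  sⱼ yⱼ = yⱼ

  assign : (Fin r → Bool) → Input n → Input n
  assign P y = tabulate λ j → assignEntry P (lookup L j) (lookup s j) (lookup y j)

  lookup-assign-layer : ∀ P y {i j} → InLayer ρ i j → lookup (assign P y) j ≡ (if P i then not (lookup s j) else lookup s j)
  lookup-assign-layer P y {j = j} j∈i =
    trans (Vec.lookup∘tabulate _ j) (cong (λ m → assignEntry P m (lookup s j) (lookup y j)) j∈i)

  lookup-assign-core : ∀ P y {j} → lookup L j ≡ nothing → lookup (assign P y) j ≡ lookup y j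
  lookup-assign-core P y {j} j-core =
    trans (Vec.lookup∘tabulate _ j) (cong (λ m → assignEntry P m (lookup s j) (lookup y j)) j-core)

  monomial-assign : ∀ P y i → monomial ρ i (assign P y) ≡ P i
  monomial-assign P y i with P i in Pᵢ
  ... | true  = monomial-true ρ i (assign P y) λ j j∈i e →
                  not-≢-self (lookup s j) (trans (sym (switched-on j j∈i)) e)
    where
    switched-on : ∀ j → InLayer ρ i j → lookup (assign P y) j ≡ not (lookup s j)
    switched-on j j∈i = trans (lookup-assign-layer P y j∈i) (cong (λ b → if b then not (lookup s j) else lookup s j) Pᵢ)
  ... | false = let j , j∈i = layer-nonempty i in
                monomial-false ρ i (assign P y) j j∈i
                  (trans (lookup-assign-layer P y j∈i) (cong (λ b → if b then not (lookup s j) else lookup s j) Pᵢ))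

  core-assign : ∀ P y → p (assign P y) ≡ p y
  core-assign P y = core-agree (assign P y) y λ j → lookup-assign-core P y

  value-assign : ∀ P y → value (assign P y) ≡ nestFin r P (p y)
  value-assign P y = nestFin-cong r (monomial-assign P y) (core-assign P y)

  allOn : Input n → Input n
  allOn = assign (λ _ → true)

  f-allOn : ∀ x → f (allOn x) ≡ not^ (pred r) (p x) xor q
  f-allOn x = begin
    f (allOn x)                           ≡⟨ f≡value (allOn x) ⟩
    value (allOn x) xor q                 ≡⟨ cong (_xor q) (value-assign (λ _ → true) x) ⟩
    nestFin r (λ _ → true) (p x) xor q    ≡⟨ cong (_xor q) (nestFin-all-true r _ (p x) (λ _ → refl)) ⟩
    not^ (pred r) (p x) xor q             ∎

  allOn-flipAt-core : ∀ x j → lookup L j ≡ nothing → allOn (flipAt x j) ≡ flipAt (allOn x) j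
  allOn-flipAt-core x j j-core = vec-ext pointwise
    where
    pointwise : ∀ l → lookup (allOn (flipAt x j)) l ≡ lookup (flipAt (allOn x) j) l
    pointwise l with l ≟F j
    ... | yes refl = begin
      lookup (allOn (flipAt x l)) l ≡⟨ lookup-assign-core _ (flipAt x l) j-core ⟩
      lookup (flipAt x l) l         ≡⟨ lookup∘flipAt x l ⟩
      not (lookup x l)              ≡⟨ cong not (lookup-assign-core _ x j-core) ⟨
      not (lookup (allOn x) l)      ≡⟨ lookup∘flipAt (allOn x) l ⟨
      lookup (flipAt (allOn x) l) l ∎
    ... | no l≢j with lookup L l in Lₗ
    ...   | nothing = begin
      lookup (allOn (flipAt x j)) l ≡⟨ lookup-assign-core _ (flipAt x j) Lₗ ⟩
      lookup (flipAt x j) l         ≡⟨ lookup∘flipAt′ x l≢j ⟩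
      lookup x l                    ≡⟨ lookup-assign-core _ x Lₗ ⟨
      lookup (allOn x) l            ≡⟨ lookup∘flipAt′ (allOn x) l≢j ⟨
      lookup (flipAt (allOn x) j) l ∎
    ...   | just i = begin
      lookup (allOn (flipAt x j)) l ≡⟨ lookup-assign-layer _ (flipAt x j) Lₗ ⟩
      not (lookup s l)              ≡⟨ lookup-assign-layer _ x Lₗ ⟨
      lookup (allOn x) l            ≡⟨ lookup∘flipAt′ (allOn x) l≢j ⟨
      lookup (flipAt (allOn x) j) l ∎

  core-essential : ∀ j → lookup L j ≡ nothing → Essential p j → Essential f j
  core-essential j j-core (x , px≢px′) = allOn x , λ e → px≢px′ (not^-injective (pred r) (xor-cancelʳ q (begin
    not^ (pred r) (p x) xor q             ≡⟨ f-allOn x ⟨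
    f (allOn x)                           ≡⟨ e ⟩
    f (flipAt (allOn x) j)                ≡⟨ cong f (allOn-flipAt-core x j j-core) ⟨
    f (allOn (flipAt x j))                ≡⟨ f-allOn (flipAt x j) ⟩
    not^ (pred r) (p (flipAt x j)) xor q  ∎)))

  z : Input n
  z = proj₁ (proj₁ (proj₂ (proj₂ valid)))

  pz≡true : p z ≡ true
  pz≡true = proj₂ (proj₁ (proj₂ (proj₂ valid)))

  onThrough : ℕ → Input n
  onThrough t = assign (λ i → does (toℕ i ≤?ℕ t)) z

  onThrough-on : ∀ t {i j} → InLayer ρ i j → toℕ i ≤ t → lookup (onThrough t) j ≢ lookup s j
  onThrough-on t {i} {j} j∈i i≤t e = not-≢-self (lookup s j) (begin
    not (lookup s j)                    ≡⟨ cong (λ b → if b then not (lookup s j) else lookup s j) (dec-true (toℕ i ≤?ℕ t) i≤t) ⟨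
    _                                   ≡⟨ lookup-assign-layer _ z j∈i ⟨
    lookup (onThrough t) j              ≡⟨ e ⟩
    lookup s j                          ∎)

  onThrough-off : ∀ t {i j} → InLayer ρ i j → t < toℕ i → lookup (onThrough t) j ≡ lookup s j
  onThrough-off t {i} {j} j∈i t<i = trans (lookup-assign-layer _ z j∈i)
    (cong (λ b → if b then not (lookup s j) else lookup s j) (dec-false (toℕ i ≤?ℕ t) (ℕ.<⇒≱ t<i)))

  f-onThrough : ∀ t → t < r → f (onThrough t) ≡ not^ t true xor q
  f-onThrough t t<r = trans (f≡value (onThrough t)) (cong (_xor q) (begin
    value (onThrough t)                           ≡⟨ value-assign _ z ⟩
    nestFin r (λ i → does (toℕ i ≤?ℕ t)) (p z)   ≡⟨ nestFin-true-upto r _ (p z) t t<r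
                                                       (λ i → dec-true (toℕ i ≤?ℕ t))
                                                       (λ i i≡1+t → dec-false (toℕ i ≤?ℕ t) (ℕ.1+n≰n ∘ subst (_≤ t) i≡1+t))
                                                       (λ _ → pz≡true) ⟩
    not^ t true                                   ∎))

  f-first-off : ∀ {t} x → t < r → (∀ i → toℕ i < t → monomial ρ i x ≡ true) →
    ∀ {i j} → InLayer ρ i j → toℕ i ≡ t → lookup x j ≡ lookup s j → f x ≡ not^ t false xor q
  f-first-off {t} x t<r on-before {i} {j} j∈i i≡t xⱼ≡sⱼ = trans (f≡value x) (cong (_xor q)
    (nestFin-first-false r _ (p x) t t<r on-before λ i′ i′≡t →
       monomial-false ρ i′ x j (subst (λ i → InLayer ρ i j) (toℕ-injective (trans i≡t (sym i′≡t))) j∈i) xⱼ≡sⱼ))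

  layered-essential : ∀ {i j} → InLayer ρ i j → Essential f j
  layered-essential {i} {j} j∈i = w , λ e → not^-true≢false t (xor-cancelʳ q (begin
    not^ t true xor q    ≡⟨ f-onThrough t (toℕ<n i) ⟨
    f w                  ≡⟨ e ⟩
    f (flipAt w j)       ≡⟨ f-first-off (flipAt w j) (toℕ<n i) on-before j∈i refl flipped ⟩
    not^ t false xor q   ∎))
    where
    t = toℕ i
    w = onThrough t
    flipped : lookup (flipAt w j) j ≡ lookup s j
    flipped = trans (lookup∘flipAt w j) (sym (¬-not (onThrough-on t j∈i ℕ.≤-refl ∘ sym)))
    on-before : ∀ i′ → toℕ i′ < t → monomial ρ i′ (flipAt w j) ≡ true
    on-before i′ i′<t = monomial-true ρ i′ (flipAt w j) λ j′ j′∈i′ → on j′ j′∈i′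
      where
      on : ∀ j′ → InLayer ρ i′ j′ → lookup (flipAt w j) j′ ≢ lookup s j′
      on j′ j′∈i′ with j′ ≟F j
      ... | yes refl = contradiction (cong toℕ (just-injective (trans (sym j′∈i′) j∈i))) (ℕ.<⇒≢ i′<t)
      ... | no j′≢j  = onThrough-on t j′∈i′ (ℕ.<⇒≤ i′<t) ∘ trans (sym (lookup∘flipAt′ w j′≢j))

  regionOf : List (Fin n) → Region n
  regionOf = map (λ j → j , lookup s j)

  ¬fresh⇒off-sign : ∀ vs {j} x → ¬ Fresh (regionOf vs) j → Inside (regionOf vs) x → lookup x j ≢ lookup s j
  ¬fresh⇒off-sign []        x ¬fresh _ = contradiction tt ¬fresh
  ¬fresh⇒off-sign (j′ ∷ vs) {j} x ¬fresh (xⱼ′≢sⱼ′ , inside) with j′ ≟F j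
  ... | yes refl = xⱼ′≢sⱼ′
  ... | no j′≢j  = ¬fresh⇒off-sign vs x (¬fresh ∘ (j′≢j ,_)) inside

  OnBelow : ℕ → Input n → Set
  OnBelow t x = ∀ {i j} → InLayer ρ i j → toℕ i < t → lookup x j ≢ lookup s j

  InLayerNo : Fin n → ℕ → Set
  InLayerNo j t = Σ (Fin r) λ i → InLayer ρ i j × toℕ i ≡ t

  FreshIn : ℕ → List (Fin n) → Set
  FreshIn t vs = Σ (Fin n) λ j → InLayerNo j t × Fresh (regionOf vs) j

  freshIn? : ∀ t vs → Dec (FreshIn t vs)
  freshIn? t vs = searchFin _ λ j → inLayerNo? j ×-dec fresh? (regionOf vs) j
    where
    inLayerNo? : ∀ j → Dec (InLayerNo j t)
    inLayerNo? j with lookup L j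
    ... | nothing = no λ { (_ , () , _) }
    ... | just i with toℕ i ≟ℕ t
    ...   | yes i≡t = yes (i , refl , i≡t)
    ...   | no  i≢t = no λ (i′ , j∈i′ , i′≡t) → i≢t (trans (cong toℕ (just-injective j∈i′)) i′≡t)

  -- The chain built so far has taken all variables of layers < t and some of layer t (those in vs).
  record Stage (t : ℕ) (vs : List (Fin n)) : Set where
    field
      t<r : t < r
      inside⇒on : ∀ x → Inside (regionOf vs) x → OnBelow t x
      on⇒inside : ∀ x → OnBelow (suc t) x → Inside (regionOf vs) x

  onThrough-onBelow : ∀ t → OnBelow (suc t) (onThrough t)
  onThrough-onBelow t j∈i (s≤s i≤t) = onThrough-on t j∈i i≤t

  stage-step : ∀ {t vs j} → Stage t vs → InLayerNo j t → Stage t (j ∷ vs)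
  stage-step stage (i , j∈i , i≡t) = record
    { t<r = t<r
    ; inside⇒on = λ x (_ , inside) → inside⇒on x inside
    ; on⇒inside = λ x on → on j∈i (s≤s (ℕ.≤-reflexive i≡t)) , on⇒inside x on
    }
    where open Stage stage

  stage-next : ∀ {t vs} → Stage t vs → ¬ FreshIn t vs → suc t < r → Stage (suc t) vs
  stage-next {t} {vs} stage ¬fresh 1+t<r = record
    { t<r = 1+t<r
    ; inside⇒on = λ x inside {i} {j} j∈i i<1+t → on-layer x inside j∈i (ℕ.m≤n⇒m<n∨m≡n (ℕ.≤-pred i<1+t))
    ; on⇒inside = λ x on → on⇒inside x λ j∈i i≤t → on j∈i (ℕ.m≤n⇒m≤1+n i≤t)
    }
    where
    open Stage stage
    on-layer : ∀ x → Inside (regionOf vs) x → ∀ {i j} → InLayer ρ i j → toℕ i < t ⊎ toℕ i ≡ t → lookup x j ≢ lookup s j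
    on-layer x inside j∈i (inj₁ i<t) = inside⇒on x inside j∈i i<t
    on-layer x inside {i} {j} j∈i (inj₂ i≡t) =
      ¬fresh⇒off-sign vs x (λ fresh → ¬fresh (j , (i , j∈i , i≡t) , fresh)) inside

  stage-next-fresh : ∀ {t vs} → Stage t vs → (1+t<r : suc t < r) → FreshIn (suc t) vs
  stage-next-fresh {t} {vs} stage 1+t<r with layer-nonempty (fromℕ< 1+t<r)
  ... | j , j∈i with fresh? (regionOf vs) j
  ...   | yes fresh = j , (fromℕ< 1+t<r , j∈i , toℕ-fromℕ< 1+t<r) , fresh
  ...   | no ¬fresh = contradiction
          (onThrough-off t j∈i (subst (t <_) (sym (toℕ-fromℕ< 1+t<r)) ℕ.≤-refl))
          (¬fresh⇒off-sign vs (onThrough t) ¬fresh (Stage.on⇒inside stage (onThrough t) (onThrough-onBelow t)))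

  layer-step : ∀ {t vs j} → Stage t vs → InLayerNo j t → Fresh (regionOf vs) j →
    CanalizingStep f (regionOf vs) j (lookup s j) (not^ t false xor q)
  layer-step {t} {vs} {j} stage (i , j∈i , i≡t) fresh =
    fresh ,
    (λ x inside xⱼ≡sⱼ → f-first-off x t<r (λ i′ i′<t → monomial-true ρ i′ x λ j′ j′∈i′ → inside⇒on x inside j′∈i′ i′<t)
                                      j∈i i≡t xⱼ≡sⱼ) ,
    onThrough t , on⇒inside (onThrough t) (onThrough-onBelow t) ,
    onThrough-on t j∈i (ℕ.≤-reflexive i≡t) ,
    λ e → not^-true≢false t (xor-cancelʳ q (trans (sym (f-onThrough t t<r)) e))
    where open Stage stage

  -- By depth-after-step a maximal chain may start with any available layer step.
  stage-bound : ∀ K {t vs} → Stage t vs → FreshIn t vs → Depth f (regionOf vs) K → r ≤ t + K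
  stage-bound zero    stage (j , j∈t , fresh) (stop ¬can) = contradiction (j , _ , _ , layer-step stage j∈t fresh) ¬can
  stage-bound (suc K) {t} {vs} stage (j , j∈t , fresh) D = continue (freshIn? t (j ∷ vs)) (suc t ℕ.<? r)
    where
    stage′ = stage-step stage j∈t
    D′ = depth-after-step (layer-step stage j∈t fresh) D
    continue : Dec (FreshIn t (j ∷ vs)) → Dec (suc t < r) → r ≤ t + suc K
    continue (yes fresh′) _ = ℕ.≤-trans (stage-bound K stage′ fresh′ D′) (ℕ.+-monoʳ-≤ t (ℕ.n≤1+n K))
    continue (no ¬fresh′) (yes 1+t<r) = subst (r ≤_) (sym (ℕ.+-suc t K))
      (stage-bound K (stage-next stage′ ¬fresh′ 1+t<r) (stage-next-fresh stage′ 1+t<r) D′)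
    continue (no _) (no 1+t≮r) = ℕ.≤-trans (ℕ.≮⇒≥ 1+t≮r) (subst (suc t ≤_) (sym (ℕ.+-suc t K)) (s≤s (ℕ.m≤m+n t K)))

  r≤depth : ∀ {K} → Depth f [] K → r ≤ K
  r≤depth {K} D with 0 ℕ.<? r
  ... | no 0≮r  = ℕ.≤-trans (ℕ.≮⇒≥ 0≮r) z≤n
  ... | yes 0<r = stage-bound K stage₀ fresh₀ D
    where
    stage₀ : Stage 0 []
    stage₀ = record { t<r = 0<r ; inside⇒on = λ _ _ _ () ; on⇒inside = λ _ _ → tt }
    fresh₀ : FreshIn 0 []
    fresh₀ = let j , j∈i = layer-nonempty (fromℕ< 0<r) in j , (fromℕ< 0<r , j∈i , toℕ-fromℕ< 0<r) , tt

-- Pointwise equal functions and dummy variables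

canalizingOn-resp-≗ : ∀ {n m} {f g : Fun n} {σ : Vec (Fin n) m} {a} → f ≗ g → CanalizingOn σ a f → CanalizingOn σ a g
canalizingOn-resp-≗ f≗g (i , σ∌i , c , d , canalizes , w , avoids , wᵢ≢c , fw≢d) =
  i , σ∌i , c , d , (λ x avoids′ xᵢ≡c → trans (sym (f≗g x)) (canalizes x avoids′ xᵢ≡c)) ,
  w , avoids , wᵢ≢c , fw≢d ∘ trans (f≗g w)

module _ {n} {f g : Fun n} (f≗g : f ≗ g) where

  essential-resp-≗ : ∀ {i} → Essential f i → Essential g i
  essential-resp-≗ {i} (x , ne) = x , λ e → ne (trans (f≗g x) (trans e (sym (f≗g (flipAt x i)))))

  kCanalizing-resp-≗ : ∀ {k σ a b} → KCanalizing {n} {k} f σ a b → KCanalizing g σ a b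
  kCanalizing-resp-≗ (canalizes , (x , avoids , fx≢b)) =
    (λ j y before yⱼ≡aⱼ → trans (sym (f≗g y)) (canalizes j y before yⱼ≡aⱼ)) ,
    (x , avoids , fx≢b ∘ trans (f≗g x))

  hasDepth-resp-≗ : ∀ k → HasDepth f k → HasDepth g k
  hasDepth-resp-≗ zero    ¬can = ¬can ∘ canalizingOn-resp-≗ {σ = []} {[]} (sym ∘ f≗g)
  hasDepth-resp-≗ (suc k) (σ , distinct , a , b , kcan , ¬can) =
    σ , distinct , a , b , kCanalizing-resp-≗ {σ = σ} {a} {b} kcan , ¬can ∘ canalizingOn-resp-≗ {σ = σ} {a} (sym ∘ f≗g)

  hasLayers-resp-≗ : ∀ r → HasLayers f r → HasLayers g r
  hasLayers-resp-≗ r (inj₁ (f≡0 , r≡0)) = inj₁ ((λ x → trans (sym (f≗g x)) (f≡0 x)) , r≡0)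
  hasLayers-resp-≗ r (inj₂ ((x , fx) , ρ , valid , f≗ρ)) =
    inj₂ ((x , trans (sym (f≗g x)) fx) , ρ , valid , λ y → trans (sym (f≗g y)) (f≗ρ y))

numEssential-resp-≗ : ∀ {n} {f g : Fun n} → f ≗ g → numEssential f ≡ numEssential g
numEssential-resp-≗ {f = f} {g} f≗g = trans (numEssential≡∑ f) (trans
  (sum-cong-≗ λ i → indicator-cong (essential? f i) (essential? g i) (essential-resp-≗ f≗g) (essential-resp-≗ (sym ∘ f≗g)))
  (sym (numEssential≡∑ g)))

module Dummy {n} (j : Fin (suc n)) (g : Fun n) where

  π : Fin n → Fin (suc n)
  π = punchIn j

  essential-liftAt⁻ : ∀ i → Essential (liftAt j g) (π i) → Essential g i
  essential-liftAt⁻ i (x , ne) = removeAt x j , λ e → ne (trans e (cong g (sym (removeAt-flipAt-punchIn x j i))))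

  essential-liftAt⁺ : ∀ i → Essential g i → Essential (liftAt j g) (π i)
  essential-liftAt⁺ i (y , ne) = insertAt y j false , λ e → ne (begin
    g y                                          ≡⟨ fixAt-liftAt j g y ⟨
    liftAt j g (insertAt y j false)              ≡⟨ e ⟩
    g (removeAt (flipAt (insertAt y j false) (π i)) j) ≡⟨ cong g (removeAt-flipAt-punchIn (insertAt y j false) j i) ⟩
    g (flipAt (removeAt (insertAt y j false) j) i)     ≡⟨ cong (λ z → g (flipAt z i)) (Vec.removeAt-insertAt y j false) ⟩
    g (flipAt y i)                               ∎)

  ¬essential-liftAt : ¬ Essential (liftAt j g) j
  ¬essential-liftAt (x , ne) = ne (cong g (sym (removeAt-flipAt-self x j)))

  numEssential-liftAt : numEssential (liftAt j g) ≡ numEssential g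
  numEssential-liftAt = begin
    numEssential (liftAt j g)
      ≡⟨ numEssential≡∑ (liftAt j g) ⟩
    ∑[ i < suc n ] indicator (essential? (liftAt j g) i)
      ≡⟨ sum-remove (λ i → indicator (essential? (liftAt j g) i)) ⟩
    indicator (essential? (liftAt j g) j) + ∑[ i < n ] indicator (essential? (liftAt j g) (π i))
      ≡⟨ cong₂ _+_ (indicator-no (essential? (liftAt j g) j) ¬essential-liftAt)
                   (sum-cong-≗ λ i → indicator-cong (essential? (liftAt j g) (π i)) (essential? g i)
                                        (essential-liftAt⁻ i) (essential-liftAt⁺ i)) ⟩
    ∑[ i < n ] indicator (essential? g i)
      ≡⟨ numEssential≡∑ g ⟨
    numEssential g ∎

  lookup-map-π : ∀ {m} (σ : Vec (Fin n) m) (x : Input (suc n)) l →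
    lookup x (lookup (Vec.map π σ) l) ≡ lookup (removeAt x j) (lookup σ l)
  lookup-map-π σ x l = trans (cong (lookup x) (Vec.lookup-map l π σ)) (sym (lookup-removeAt x j (lookup σ l)))

  lookup-insertAt-map-π : ∀ {m} (σ : Vec (Fin n) m) y l →
    lookup (insertAt y j false) (lookup (Vec.map π σ) l) ≡ lookup y (lookup σ l)
  lookup-insertAt-map-π σ y l =
    trans (lookup-map-π σ (insertAt y j false) l) (cong (λ z → lookup z (lookup σ l)) (Vec.removeAt-insertAt y j false))

  avoids-removeAt : ∀ {m} (σ : Vec (Fin n) m) a x → Avoids (Vec.map π σ) a x → Avoids σ a (removeAt x j)
  avoids-removeAt σ a x avoids l = avoids l ∘ trans (lookup-map-π σ x l)

  avoids-insertAt : ∀ {m} (σ : Vec (Fin n) m) a y → Avoids σ a y → Avoids (Vec.map π σ) a (insertAt y j false)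
  avoids-insertAt σ a y avoids l =
    avoids l ∘ trans (sym (lookup-insertAt-map-π σ y l))

  ∉-map-π : ∀ {m} (σ : Vec (Fin n) m) {i} → (∀ l → lookup σ l ≢ i) → ∀ l → lookup (Vec.map π σ) l ≢ π i
  ∉-map-π σ σ∌i l e = σ∌i l (punchIn-injective j _ _ (trans (sym (Vec.lookup-map l π σ)) e))

  canalizingOn-liftAt⁺ : ∀ {m} (σ : Vec (Fin n) m) a → CanalizingOn σ a g → CanalizingOn (Vec.map π σ) a (liftAt j g)
  canalizingOn-liftAt⁺ σ a (i , σ∌i , c , d , canalizes , w , avoids , wᵢ≢c , gw≢d) =
    π i , ∉-map-π σ σ∌i , c , d ,
    (λ x avoids′ xᵢ≡c → canalizes (removeAt x j) (avoids-removeAt σ a x avoids′) (trans (lookup-removeAt x j i) xᵢ≡c)) ,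
    insertAt w j false , avoids-insertAt σ a w avoids ,
    wᵢ≢c ∘ trans (sym (Vec.insertAt-punchIn w j false i)) ,
    gw≢d ∘ trans (sym (fixAt-liftAt j g w))

  canalizingOn-liftAt⁻ : ∀ {m} (σ : Vec (Fin n) m) a → CanalizingOn (Vec.map π σ) a (liftAt j g) → CanalizingOn σ a g
  canalizingOn-liftAt⁻ σ a (i′ , σ∌i′ , c , d , canalizes , w , avoids , wᵢ′≢c , gw≢d) with j ≟F i′
  ... | yes refl = contradiction
        (trans (cong g (sym (removeAt-flipAt-self w j)))
               (canalizes (flipAt w j) avoids-flipped (trans (lookup∘flipAt w j) (sym (¬-not (wᵢ′≢c ∘ sym))))))
        gw≢d
    where
    -- A dummy variable cannot canalize.
    avoids-flipped : Avoids (Vec.map π σ) a (flipAt w j)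
    avoids-flipped l = avoids l ∘ trans (sym (lookup∘flipAt′ w (punchInᵢ≢i j _ ∘ trans (sym (Vec.lookup-map l π σ)))))
  ... | no j≢i′ = i , σ∌i , c , d ,
        (λ y avoids′ yᵢ≡c → trans (sym (fixAt-liftAt j g y))
           (canalizes (insertAt y j false) (avoids-insertAt σ a y avoids′)
             (trans (cong (lookup (insertAt y j false)) (sym πi≡i′)) (trans (Vec.insertAt-punchIn y j false i) yᵢ≡c)))) ,
        removeAt w j , avoids-removeAt σ a w avoids ,
        wᵢ′≢c ∘ trans (trans (cong (lookup w) (sym πi≡i′)) (sym (lookup-removeAt w j i))) ,
        gw≢d
    where
    i = punchOut j≢i′
    πi≡i′ : π i ≡ i′
    πi≡i′ = punchIn-punchOut j≢i′
    σ∌i : ∀ l → lookup σ l ≢ i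
    σ∌i l e = σ∌i′ l (trans (Vec.lookup-map l π σ) (trans (cong π e) πi≡i′))

  kCanalizing-liftAt⁺ : ∀ {k} σ a b → KCanalizing {n} {k} g σ a b → KCanalizing (liftAt j g) (Vec.map π σ) a b
  kCanalizing-liftAt⁺ σ a b (canalizes , (y , avoids , gy≢b)) =
    (λ l x before xₗ≡aₗ → canalizes l (removeAt x j)
       (λ l′ l′<l → before l′ l′<l ∘ trans (lookup-map-π σ x l′)) (trans (sym (lookup-map-π σ x l)) xₗ≡aₗ)) ,
    (insertAt y j false , avoids-insertAt σ a y avoids , gy≢b ∘ trans (sym (fixAt-liftAt j g y)))

  kCanalizing-liftAt⁻ : ∀ {k} σ a b → KCanalizing {suc n} {k} (liftAt j g) (Vec.map π σ) a b → KCanalizing g σ a b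
  kCanalizing-liftAt⁻ σ a b (canalizes , (x , avoids , gx≢b)) =
    (λ l y before yₗ≡aₗ → trans (sym (fixAt-liftAt j g y)) (canalizes l (insertAt y j false)
       (λ l′ l′<l → before l′ l′<l ∘ trans (sym (lookup-insertAt-map-π σ y l′)))
       (trans (lookup-insertAt-map-π σ y l) yₗ≡aₗ))) ,
    (removeAt x j , avoids-removeAt σ a x avoids , gx≢b)

  distinct-map-π⁺ : ∀ {m} (σ : Vec (Fin n) m) → Distinct σ → Distinct (Vec.map π σ)
  distinct-map-π⁺ σ distinct l l′ e =
    distinct l l′ (punchIn-injective j _ _ (trans (sym (Vec.lookup-map l π σ)) (trans e (Vec.lookup-map l′ π σ))))

  distinct-map-π⁻ : ∀ {m} (σ : Vec (Fin n) m) → Distinct (Vec.map π σ) → Distinct σ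
  distinct-map-π⁻ σ distinct l l′ e =
    distinct l l′ (trans (Vec.lookup-map l π σ) (trans (cong π e) (sym (Vec.lookup-map l′ π σ))))

  hasDepth-liftAt⁺ : ∀ k → HasDepth g k → HasDepth (liftAt j g) k
  hasDepth-liftAt⁺ zero    ¬can = ¬can ∘ canalizingOn-liftAt⁻ [] []
  hasDepth-liftAt⁺ (suc k) (σ , distinct , a , b , kcan , ¬can) =
    Vec.map π σ , distinct-map-π⁺ σ distinct , a , b , kCanalizing-liftAt⁺ σ a b kcan , ¬can ∘ canalizingOn-liftAt⁻ σ a

  hasDepth-liftAt⁻ : ∀ k → HasDepth (liftAt j g) k → HasDepth g k
  hasDepth-liftAt⁻ zero    ¬can = ¬can ∘ canalizingOn-liftAt⁺ [] []
  hasDepth-liftAt⁻ (suc k) (σ′ , distinct′ , a , b , kcan′ , ¬can′) =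
    σ , distinct-map-π⁻ σ distinct , a , b , kCanalizing-liftAt⁻ σ a b kcan , ¬can ∘ canalizingOn-liftAt⁺ σ a
    where
    -- Canalizing variables are essential, so σ′ avoids the dummy variable j.
    σ′∌j : ∀ l → j ≢ lookup σ′ l
    σ′∌j l e = ¬essential-liftAt (subst (Essential (liftAt j g)) (sym e) (kCanalizing-essential σ′ a b kcan′ distinct′ l))
    σ : Vec (Fin n) (suc k)
    σ = tabulate (punchOut ∘ σ′∌j)
    σ′≡ : σ′ ≡ Vec.map π σ
    σ′≡ = vec-ext λ l → sym (trans (Vec.lookup-map l π σ)
                              (trans (cong π (Vec.lookup∘tabulate (punchOut ∘ σ′∌j) l)) (punchIn-punchOut (σ′∌j l))))
    Good : Vec (Fin (suc n)) (suc k) → Set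
    Good τ = Distinct τ × KCanalizing (liftAt j g) τ a b × ¬ CanalizingOn τ a (liftAt j g)
    good : Good (Vec.map π σ)
    good = subst Good σ′≡ (distinct′ , kcan′ , ¬can′)
    distinct = proj₁ good
    kcan = proj₁ (proj₂ good)
    ¬can = proj₂ (proj₂ good)

sideCond-transport : ∀ {n m} r (ρ : Rep n r) (ρ′ : Rep m r) → (CoreOne ρ′ → CoreOne ρ) →
  (∀ i → layerSize ρ i ≡ layerSize ρ′ i) → qconst ρ ≡ qconst ρ′ → SideCond r ρ → SideCond r ρ′
sideCond-transport zero          ρ ρ′ one sizes q≡ side = trans (sym q≡) side
sideCond-transport (suc zero)    ρ ρ′ one sizes q≡ side one′ size≡1 = trans (sym q≡) (side (one one′) (trans (sizes zero) size≡1))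
sideCond-transport (suc (suc r)) ρ ρ′ one sizes q≡ side one′ = ℕ.≤-trans (side (one one′)) (ℕ.≤-reflexive (sizes _))

-- ρ⁺ is ρ with the extra variable j put into the core, where p_C ignores it.
module WithDummy {n r} (j : Fin (suc n)) (ρ⁺ : Rep (suc n) r) (ρ : Rep n r)
  (j-core : lookup (layer ρ⁺) j ≡ nothing)
  (layer-π : ∀ l → lookup (layer ρ⁺) (punchIn j l) ≡ lookup (layer ρ) l)
  (sign-π : ∀ l → lookup (sign ρ⁺) (punchIn j l) ≡ lookup (sign ρ) l)
  (core≗ : eval (core ρ⁺) ≗ liftAt j (eval (core ρ)))
  (q≡ : qconst ρ⁺ ≡ qconst ρ) where

  open Dummy j (eval (core ρ))

  j-or-π : ∀ l → l ≡ j ⊎ Σ (Fin n) λ l′ → π l′ ≡ l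
  j-or-π l with j ≟F l
  ... | yes j≡l = inj₁ (sym j≡l)
  ... | no j≢l  = inj₂ (punchOut j≢l , punchIn-punchOut j≢l)

  layerSize-≡ : ∀ i → layerSize ρ⁺ i ≡ layerSize ρ i
  layerSize-≡ i = begin
    layerSize ρ⁺ i
      ≡⟨ length-filter-allFin (inLayer? ρ⁺ i) ⟩
    ∑[ l < suc n ] indicator (inLayer? ρ⁺ i l)
      ≡⟨ sum-remove (λ l → indicator (inLayer? ρ⁺ i l)) ⟩
    indicator (inLayer? ρ⁺ i j) + ∑[ l < n ] indicator (inLayer? ρ⁺ i (π l))
      ≡⟨ cong₂ _+_ (indicator-no (inLayer? ρ⁺ i j) λ j∈i → contradiction (trans (sym j-core) j∈i) λ ())
                   (sum-cong-≗ λ l → indicator-cong (inLayer? ρ⁺ i (π l)) (inLayer? ρ i l)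
                                        (trans (sym (layer-π l))) (trans (layer-π l))) ⟩
    ∑[ l < n ] indicator (inLayer? ρ i l)
      ≡⟨ length-filter-allFin (inLayer? ρ i) ⟨
    layerSize ρ i ∎

  monomial-≡ : ∀ i x → monomial ρ⁺ i x ≡ monomial ρ i (removeAt x j)
  monomial-≡ i x = ≡true⇔⇒≡
    (λ M⁺ → monomial-true ρ i (removeAt x j) λ l l∈i e →
       monomial-true⁻ ρ⁺ i x M⁺ (π l) (trans (layer-π l) l∈i) (trans (sym (lookup-removeAt x j l)) (trans e (sym (sign-π l)))))
    (λ M → monomial-true ρ⁺ i x λ l l∈i → off l l∈i M (j-or-π l))
    where
    off : ∀ l → InLayer ρ⁺ i l → monomial ρ i (removeAt x j) ≡ true → l ≡ j ⊎ Σ (Fin n) (λ l′ → π l′ ≡ l) →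
          lookup x l ≢ lookup (sign ρ⁺) l
    off l l∈i M (inj₁ refl) = contradiction (trans (sym j-core) l∈i) λ ()
    off l l∈i M (inj₂ (l′ , refl)) e = monomial-true⁻ ρ i (removeAt x j) M l′ (trans (sym (layer-π l′)) l∈i)
      (trans (lookup-removeAt x j l′) (trans e (sign-π l′)))

  repEval-≡ : ∀ x → repEval ρ⁺ x ≡ repEval ρ (removeAt x j)
  repEval-≡ x = begin
    repEval ρ⁺ x
      ≡⟨ repEval≡nestFin ρ⁺ x ⟩
    nestFin r (λ i → monomial ρ⁺ i x) (eval (core ρ⁺) x) xor qconst ρ⁺
      ≡⟨ cong₂ _xor_ (nestFin-cong r (λ i → monomial-≡ i x) (core≗ x)) q≡ ⟩
    nestFin r (λ i → monomial ρ i (removeAt x j)) (eval (core ρ) (removeAt x j)) xor qconst ρ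
      ≡⟨ repEval≡nestFin ρ (removeAt x j) ⟨
    repEval ρ (removeAt x j) ∎

  valid⁻ : ValidRep ρ⁺ → ValidRep ρ
  valid⁻ (nonempty , core-vars , (x , px) , ¬can , side) =
    (λ i → subst (1 ≤_) (layerSize-≡ i) (nonempty i)) ,
    (λ l layered ess → core-vars (π l) (layered ∘ trans (sym (layer-π l)))
                          (essential-resp-≗ (sym ∘ core≗) (essential-liftAt⁺ l ess))) ,
    (removeAt x j , trans (sym (core≗ x)) px) ,
    ¬can ∘ canalizingOn-resp-≗ {σ = []} {[]} (sym ∘ core≗) ∘ canalizingOn-liftAt⁺ [] [] ,
    sideCond-transport r ρ⁺ ρ (λ one x′ → trans (core≗ x′) (one (removeAt x′ j))) layerSize-≡ q≡ side

  valid⁺ : ValidRep ρ → ValidRep ρ⁺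
  valid⁺ (nonempty , core-vars , (y , py) , ¬can , side) =
    (λ i → subst (1 ≤_) (sym (layerSize-≡ i)) (nonempty i)) ,
    (λ l layered ess → ignored l layered ess (j-or-π l)) ,
    (insertAt y j false , trans (core≗ (insertAt y j false)) (trans (fixAt-liftAt j (eval (core ρ)) y) py)) ,
    ¬can ∘ canalizingOn-liftAt⁻ [] [] ∘ canalizingOn-resp-≗ {σ = []} {[]} core≗ ,
    sideCond-transport r ρ ρ⁺
      (λ one y′ → trans (sym (fixAt-liftAt j (eval (core ρ)) y′))
                    (trans (sym (core≗ (insertAt y′ j false))) (one (insertAt y′ j false))))
      (sym ∘ layerSize-≡) (sym q≡) side
    where
    ignored : ∀ l → lookup (layer ρ⁺) l ≢ nothing → Essential (eval (core ρ⁺)) l →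
              l ≡ j ⊎ Σ (Fin n) (λ l′ → π l′ ≡ l) → ⊥
    ignored l layered ess (inj₁ refl) = layered j-core
    ignored l layered ess (inj₂ (l′ , refl)) =
      core-vars l′ (layered ∘ trans (layer-π l′)) (essential-liftAt⁻ l′ (essential-resp-≗ core≗ ess))

hasLayers-liftAt⁺ : ∀ {n} j (g : Fun n) r → HasLayers g r → HasLayers (liftAt j g) r
hasLayers-liftAt⁺ j g r (inj₁ (g≡0 , r≡0)) = inj₁ ((λ x → g≡0 (removeAt x j)) , r≡0)
hasLayers-liftAt⁺ {n} j g r (inj₂ ((y , gy) , ρ , valid , g≗ρ)) =
  inj₂ ((insertAt y j false , trans (fixAt-liftAt j g y) gy) , ρ⁺ , valid⁺ valid ,
        λ x → trans (g≗ρ (removeAt x j)) (sym (repEval-≡ x)))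
  where
  ρ⁺ : Rep (suc n) r
  ρ⁺ = insertAt (layer ρ) j nothing , insertAt (sign ρ) j false , tabulateBF (liftAt j (eval (core ρ))) , qconst ρ
  open WithDummy j ρ⁺ ρ (Vec.insertAt-lookup (layer ρ) j nothing) (Vec.insertAt-punchIn (layer ρ) j nothing)
                 (Vec.insertAt-punchIn (sign ρ) j false) (eval-tabulateBF (liftAt j (eval (core ρ)))) refl

hasLayers-liftAt⁻ : ∀ {n} j (g : Fun n) r → HasLayers (liftAt j g) r → HasLayers g r
hasLayers-liftAt⁻ j g r (inj₁ (g≡0 , r≡0)) =
  inj₁ ((λ y → trans (sym (fixAt-liftAt j g y)) (g≡0 (insertAt y j false))) , r≡0)
hasLayers-liftAt⁻ {n} j g r (inj₂ ((x , gx) , ρ⁺ , valid , g≗ρ⁺)) =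
  inj₂ ((removeAt x j , gx) , ρ , valid⁻ valid ,
        λ y → begin
          g y                                       ≡⟨ fixAt-liftAt j g y ⟨
          liftAt j g (insertAt y j false)           ≡⟨ g≗ρ⁺ (insertAt y j false) ⟩
          repEval ρ⁺ (insertAt y j false)           ≡⟨ repEval-≡ (insertAt y j false) ⟩
          repEval ρ (removeAt (insertAt y j false) j) ≡⟨ cong (repEval ρ) (Vec.removeAt-insertAt y j false) ⟩
          repEval ρ y                               ∎)
  where
  open Represented ρ⁺ valid (liftAt j g) g≗ρ⁺
  open Dummy j g using (¬essential-liftAt)
  -- The dummy variable j is inessential, hence neither layered nor essential in the core.
  j-core : lookup (layer ρ⁺) j ≡ nothing
  j-core with lookup (layer ρ⁺) j in Lⱼ
  ... | nothing = refl
  ... | just i  = contradiction (layered-essential Lⱼ) ¬essential-liftAt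
  core-ignores-j : ¬ Essential (eval (core ρ⁺)) j
  core-ignores-j = ¬essential-liftAt ∘ core-essential j j-core
  ρ : Rep n r
  ρ = removeAt (layer ρ⁺) j , removeAt (sign ρ⁺) j , tabulateBF (fixAt j (eval (core ρ⁺))) , qconst ρ⁺
  open WithDummy j ρ⁺ ρ j-core (sym ∘ lookup-removeAt (layer ρ⁺) j) (sym ∘ lookup-removeAt (sign ρ⁺) j)
                 (λ x → sym (trans (eval-tabulateBF (fixAt j (eval (core ρ⁺)))  (removeAt x j))
                                   (liftAt-fixAt j (eval (core ρ⁺)) core-ignores-j x)))
                 refl

-- The counts N(n,m,k,r)

Class : ∀ {n} → ℕ → ℕ → ℕ → Fun n → Set
Class m k r f = numEssential f ≡ m × HasDepth f k × HasLayers f r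

class? : ∀ {n} m k r (f : Fun n) → Dec (Class m k r f)
class? m k r f = (numEssential f ≟ℕ m) ×-dec (hasDepth? f k ×-dec hasLayers? f r)

class-resp-≗ : ∀ {n m k r} {f g : Fun n} → f ≗ g → Class m k r f → Class m k r g
class-resp-≗ {k = k} {r} f≗g (ess , depth , layers) =
  trans (sym (numEssential-resp-≗ f≗g)) ess , hasDepth-resp-≗ f≗g k depth , hasLayers-resp-≗ f≗g r layers

class-liftAt⁺ : ∀ {n m k r} j {g : Fun n} → Class m k r g → Class m k r (liftAt j g)
class-liftAt⁺ {k = k} {r} j {g} (ess , depth , layers) =
  trans (Dummy.numEssential-liftAt j g) ess , Dummy.hasDepth-liftAt⁺ j g k depth , hasLayers-liftAt⁺ j g r layers

class-liftAt⁻ : ∀ {n m k r} j {g : Fun n} → Class m k r (liftAt j g) → Class m k r g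
class-liftAt⁻ {k = k} {r} j {g} (ess , depth , layers) =
  trans (sym (Dummy.numEssential-liftAt j g)) ess , Dummy.hasDepth-liftAt⁻ j g k depth , hasLayers-liftAt⁻ j g r layers

count-inessential-at : ∀ {n} m k r (j : Fin (suc n)) →
  length (filter (λ F → ¬? (essential? (eval F) j) ×-dec class? m k r (eval F)) (allBF (suc n))) ≡ N n m k r
count-inessential-at {n} m k r j = count-bijection _ (class? m k r ∘ eval) Φ Ψ
  (λ F (¬ess , cls) → class-resp-≗ (sym ∘ eval-tabulateBF _)
                        (class-liftAt⁻ j (class-resp-≗ (sym ∘ liftAt-fixAt j (eval F) ¬ess) cls)))
  (λ G cls → (λ ess → Dummy.¬essential-liftAt j (eval G) (essential-resp-≗ (eval-tabulateBF _) ess)) ,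
             class-resp-≗ (sym ∘ eval-tabulateBF _) (class-liftAt⁺ j cls))
  (λ F (¬ess , _) → eval-injective (Ψ (Φ F)) F λ x →
     trans (eval-tabulateBF (liftAt j (eval (Φ F))) x)
       (trans (eval-tabulateBF (fixAt j (eval F)) (removeAt x j)) (liftAt-fixAt j (eval F) ¬ess x)))
  (λ G _ → eval-injective (Φ (Ψ G)) G λ y →
     trans (eval-tabulateBF (fixAt j (eval (Ψ G))) y)
       (trans (eval-tabulateBF (liftAt j (eval G)) (insertAt y j false)) (fixAt-liftAt j (eval G) y)))
  where
  Φ : BF (suc n) → BF n
  Φ F = tabulateBF (fixAt j (eval F))
  Ψ : BF n → BF (suc n)
  Ψ G = tabulateBF (liftAt j (eval G))

numInessential : ∀ {n} (f : Fun n) → ∑[ j < n ] indicator (¬? (essential? f j)) ≡ n ∸ numEssential f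
numInessential {n} f = sym (begin
  n ∸ numEssential f
    ≡⟨ cong₂ _∸_ (sym (trans (sum-cong-≗ λ j → complementary (essential? f j)) (trans (∑-const n 1) (ℕ.*-identityʳ n))))
                 (numEssential≡∑ f) ⟩
  ∑[ j < n ] (inessential j + essential j) ∸ ∑[ j < n ] essential j
    ≡⟨ cong (_∸ ∑[ j < n ] essential j) (∑-distrib-+ inessential essential) ⟩
  ∑[ j < n ] inessential j + ∑[ j < n ] essential j ∸ ∑[ j < n ] essential j
    ≡⟨ ℕ.m+n∸n≡m (∑[ j < n ] inessential j) (∑[ j < n ] essential j) ⟩
  ∑[ j < n ] inessential j ∎)
  where
  inessential essential : Fin n → ℕ
  inessential j = indicator (¬? (essential? f j))
  essential j = indicator (essential? f j)
  complementary : ∀ {P : Set} (d : Dec P) → indicator (¬? d) + indicator d ≡ 1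
  complementary (yes _) = refl
  complementary (no _)  = refl

-- Double counting the pairs (f, j) with f in the class and x_j inessential in f.
N-recurrence : ∀ n m k r → (suc n ∸ m) * N (suc n) m k r ≡ suc n * N n m k r
N-recurrence n m k r = begin
  (suc n ∸ m) * N (suc n) m k r
    ≡⟨ cong ((suc n ∸ m) *_) (length-filter≡sum _ (allBF (suc n))) ⟩
  (suc n ∸ m) * sum (map (indicator ∘ inClass) (allBF (suc n)))
    ≡⟨ sum-map-*ˡ (suc n ∸ m) _ (allBF (suc n)) ⟨
  sum (map (λ F → (suc n ∸ m) * indicator (inClass F)) (allBF (suc n)))
    ≡⟨ sum-map-cong per-function (allBF (suc n)) ⟨
  sum (map (λ F → ∑[ j < suc n ] pair F j) (allBF (suc n)))
    ≡⟨ ∑-sum-comm (λ j F → pair F j) (allBF (suc n)) ⟨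
  ∑[ j < suc n ] sum (map (λ F → pair F j) (allBF (suc n)))
    ≡⟨ sum-cong-≗ (λ j → trans (sym (length-filter≡sum (λ F → ¬? (essential? (eval F) j) ×-dec inClass F) (allBF (suc n))))
                                (count-inessential-at m k r j)) ⟩
  ∑[ j < suc n ] N n m k r
    ≡⟨ ∑-const (suc n) (N n m k r) ⟩
  suc n * N n m k r ∎
  where
  inClass : (F : BF (suc n)) → Dec (Class m k r (eval F))
  inClass F = class? m k r (eval F)
  pair : BF (suc n) → Fin (suc n) → ℕ
  pair F j = indicator (¬? (essential? (eval F) j) ×-dec inClass F)
  per-function : ∀ F → ∑[ j < suc n ] pair F j ≡ (suc n ∸ m) * indicator (inClass F)
  per-function F = begin
    ∑[ j < suc n ] pair F j
      ≡⟨ sum-cong-≗ (λ j → indicator-× (¬? (essential? (eval F) j)) (inClass F)) ⟩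
    ∑[ j < suc n ] (indicator (¬? (essential? (eval F) j)) * indicator (inClass F))
      ≡⟨ *-distribʳ-sum (indicator (inClass F)) (λ j → indicator (¬? (essential? (eval F) j))) ⟨
    ∑[ j < suc n ] indicator (¬? (essential? (eval F) j)) * indicator (inClass F)
      ≡⟨ cong (_* indicator (inClass F)) (numInessential (eval F)) ⟩
    (suc n ∸ numEssential (eval F)) * indicator (inClass F)
      ≡⟨ in-class (inClass F) ⟩
    (suc n ∸ m) * indicator (inClass F) ∎
    where
    in-class : (d : Dec (Class m k r (eval F))) → (suc n ∸ numEssential (eval F)) * indicator d ≡ (suc n ∸ m) * indicator d
    in-class (yes (ess , _)) = cong (λ e → (suc n ∸ e) * 1) ess
    in-class (no _)          = trans (ℕ.*-zeroʳ (suc n ∸ numEssential (eval F))) (sym (ℕ.*-zeroʳ (suc n ∸ m)))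

nCk*k![n∸k]!≡n! : ∀ {n k} → k ≤ n → (n C k) * (k ! * (n ∸ k) !) ≡ n !
nCk*k![n∸k]!≡n! {n} {k} k≤n = trans (cong (_* (k ! * (n ∸ k) !)) (nCk≡n!/k![n-k]! k≤n))
                                    (m/n*n≡m {{k ℕ.!* (n ∸ k) !≢0}} (k![n∸k]!∣n! k≤n))

[1+n∸m]*[1+n]Cm≡[1+n]*nCm : ∀ n m → m ≤ n → (suc n ∸ m) * (suc n C m) ≡ suc n * (n C m)
[1+n∸m]*[1+n]Cm≡[1+n]*nCm n m m≤n = ℕ.*-cancelʳ-≡ _ _ (m ! * d !) {{m ℕ.!* d !≢0}} (begin
  (suc n ∸ m) * (suc n C m) * (m ! * d !)       ≡⟨ cong (λ e → e * (suc n C m) * (m ! * d !)) 1+n∸m≡1+d ⟩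
  suc d * (suc n C m) * (m ! * d !)             ≡⟨ regroup (suc n C m) (m !) (d !) d ⟩
  (suc n C m) * (m ! * (suc d) !)               ≡⟨ cong (λ e → (suc n C m) * (m ! * e !)) 1+n∸m≡1+d ⟨
  (suc n C m) * (m ! * (suc n ∸ m) !)           ≡⟨ nCk*k![n∸k]!≡n! (ℕ.m≤n⇒m≤1+n m≤n) ⟩
  suc n !                                       ≡⟨ cong (λ e → e + n * e) (nCk*k![n∸k]!≡n! m≤n) ⟨
  (n C m) * (m ! * d !) + n * ((n C m) * (m ! * d !)) ≡⟨ collect (n C m) (m ! * d !) n ⟩
  suc n * (n C m) * (m ! * d !)                 ∎)
  where
  d = n ∸ m
  1+n∸m≡1+d : suc n ∸ m ≡ suc d
  1+n∸m≡1+d = ℕ.+-∸-assoc 1 m≤n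
  regroup : ∀ a b c d → suc d * a * (b * c) ≡ a * (b * (c + d * c))
  regroup = solve-∀
  collect : ∀ a b n → a * b + n * (a * b) ≡ suc n * a * b
  collect = solve-∀

N-diagonal : ∀ m k r → N m m k r ≡ (m C m) * N m m k r
N-diagonal m k r = sym (trans (cong (_* N m m k r) (nCn≡1 m)) (ℕ.*-identityˡ (N m m k r)))

N-step : ∀ {n m} k r → m ≤ n → N n m k r ≡ (n C m) * N m m k r → N (suc n) m k r ≡ (suc n C m) * N m m k r
N-step {n} {m} k r m≤n ih = ℕ.*-cancelˡ-≡ _ _ (suc n ∸ m) {{nonZero}} (begin
  (suc n ∸ m) * N (suc n) m k r           ≡⟨ N-recurrence n m k r ⟩
  suc n * N n m k r                       ≡⟨ cong (suc n *_) ih ⟩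
  suc n * ((n C m) * N m m k r)           ≡⟨ ℕ.*-assoc (suc n) (n C m) (N m m k r) ⟨
  suc n * (n C m) * N m m k r             ≡⟨ cong (_* N m m k r) ([1+n∸m]*[1+n]Cm≡[1+n]*nCm n m m≤n) ⟨
  (suc n ∸ m) * (suc n C m) * N m m k r   ≡⟨ ℕ.*-assoc (suc n ∸ m) (suc n C m) (N m m k r) ⟩
  (suc n ∸ m) * ((suc n C m) * N m m k r) ∎)
  where
  nonZero : NonZero (suc n ∸ m)
  nonZero = subst NonZero (sym (ℕ.+-∸-assoc 1 m≤n)) _

N-binomial : ∀ {n m} k r → m ≤ n → N n m k r ≡ (n C m) * N m m k r
N-binomial {zero}  {zero} k r z≤n   = N-diagonal 0 k r
N-binomial {suc n} {m}    k r m≤1+n = by-cases (ℕ.m≤n⇒m<n∨m≡n m≤1+n)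
  where
  by-cases : m < suc n ⊎ m ≡ suc n → N (suc n) m k r ≡ (suc n C m) * N m m k r
  by-cases (inj₁ (s≤s m≤n)) = N-step k r m≤n (N-binomial k r m≤n)
  by-cases (inj₂ m≡1+n)     = subst (λ n′ → N n′ m k r ≡ (n′ C m) * N m m k r) m≡1+n (N-diagonal m k r)

layers≤depth : ∀ {n} {f : Fun n} {k r} → HasDepth f k → HasLayers f r → r ≤ k
layers≤depth             hasDepth (inj₁ (_ , refl))               = z≤n
layers≤depth {f = f} {k} hasDepth (inj₂ (_ , ρ , valid , f≗ρ)) =
  Represented.r≤depth ρ valid f f≗ρ (hasDepth⇒depth k hasDepth)

N-vanishes : ∀ n m k r → m < k ⊎ k < r → N n m k r ≡ 0
N-vanishes n m k r m<k⊎k<r = length-filter-none (class? m k r ∘ eval) (λ F → outside (eval F)) (allBF n)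
  where
  outside : (f : Fun n) → ¬ Class m k r f
  outside f (ess , depth , layers) =
    [ (λ m<k → ℕ.<⇒≱ m<k (subst (k ≤_) ess (depth≤numEssential k depth)))
    , (λ k<r → ℕ.<⇒≱ k<r (layers≤depth depth layers))
    ]′ m<k⊎k<r

constant⇒¬essential : ∀ {n} {f : Fun n} {b} → (∀ x → f x ≡ b) → ∀ i → ¬ Essential f i
constant⇒¬essential f≡b i (x , ne) = ne (trans (f≡b x) (sym (f≡b (flipAt x i))))

constant⇒¬canalizing : ∀ {n} {f : Fun n} {b} → (∀ x → f x ≡ b) → ¬ Canalizing f
constant⇒¬canalizing {f = f} f≡b (i , _ , c , d , canalizes , w , _ , _ , fw≢d) =
  fw≢d (trans (f≡b w) (trans (sym (f≡b (setAt w i c))) (canalizes (setAt w i c) (λ ()) (lookup∘setAt w i c))))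

constantBF : ∀ n → Bool → BF n
constantBF n b = tabulateBF (λ _ → b)

constantBF-class : ∀ {n} b → Class 0 0 0 (eval (constantBF n b))
constantBF-class {n} b =
  length-filter-none (essential? f) (constant⇒¬essential (eval-tabulateBF _)) (List.allFin n) ,
  constant⇒¬canalizing (eval-tabulateBF _) ,
  layers b
  where
  f = eval (constantBF n b)
  ρ₁ : Rep n 0
  ρ₁ = replicate n nothing , replicate n false , constantBF n true , false
  one : ∀ x → eval (core ρ₁) x ≡ true
  one = eval-tabulateBF _
  layers : ∀ b → HasLayers (eval (constantBF n b)) 0
  layers false = inj₁ (eval-tabulateBF _ , refl)
  layers true  = inj₂ ((replicate n false , one _) , ρ₁ ,
    ((λ ()) , (λ j _ → constant⇒¬essential one j) , (replicate n false , one _) , constant⇒¬canalizing one , refl) ,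
    λ x → trans (one x) (sym (trans (xor-identityʳ _) (one x))))

numEssential≡0⇒¬essential : ∀ {n} (f : Fun n) → numEssential f ≡ 0 → ∀ i → ¬ Essential f i
numEssential≡0⇒¬essential f none i ess = ℕ.<⇒≢ (List.filter-some (essential? f) (lose (∈-allFin i) ess)) (sym none)

numEssential≡0⇒constant : ∀ {n} (f : Fun n) → numEssential f ≡ 0 → ∀ x y → f x ≡ f y
numEssential≡0⇒constant f none x y =
  agree-off-inessential f (λ _ → ⊤) (λ i _ → numEssential≡0⇒¬essential f none i) x y (λ _ ¬⊤ → contradiction tt ¬⊤)

class₀⇒constant : ∀ {n} (F : BF n) → Class 0 0 0 (eval F) → F ≡ constantBF n false ⊎ F ≡ constantBF n true
class₀⇒constant {n} F (none , _) = by-value (eval F (replicate n false)) refl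
  where
  ≡constant : ∀ b → eval F (replicate n false) ≡ b → F ≡ constantBF n b
  ≡constant b F₀≡b = eval-injective F _ λ x →
    trans (numEssential≡0⇒constant (eval F) none x _) (trans F₀≡b (sym (eval-tabulateBF _ x)))
  by-value : ∀ b → eval F (replicate n false) ≡ b → F ≡ constantBF n false ⊎ F ≡ constantBF n true
  by-value false F₀≡b = inj₁ (≡constant false F₀≡b)
  by-value true  F₀≡b = inj₂ (≡constant true F₀≡b)

N-constants : ∀ n → N n 0 0 0 ≡ 2
N-constants n = begin
  N n 0 0 0
    ≡⟨ length-filter≡sum (class? 0 0 0 ∘ eval) (allBF n) ⟩
  sum (map (indicator ∘ class? 0 0 0 ∘ eval) (allBF n))
    ≡⟨ sum-map-cong constant-or-not (allBF n) ⟩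
  sum (map (λ F → indicator (F ≟BF c₀) + indicator (F ≟BF c₁)) (allBF n))
    ≡⟨ sum-map-+ (λ F → indicator (F ≟BF c₀)) (λ F → indicator (F ≟BF c₁)) (allBF n) ⟩
  sum (map (λ F → indicator (F ≟BF c₀)) (allBF n)) + sum (map (λ F → indicator (F ≟BF c₁)) (allBF n))
    ≡⟨ cong₂ _+_ (allBF-complete n c₀) (allBF-complete n c₁) ⟩
  2 ∎
  where
  c₀ = constantBF n false
  c₁ = constantBF n true
  c₀≢c₁ : c₀ ≢ c₁
  c₀≢c₁ e with trans (sym (eval-tabulateBF _ (replicate n false)))
                     (trans (cong (λ F → eval F (replicate n false)) e) (eval-tabulateBF _ (replicate n false)))
  ... | ()
  constant-or-not : ∀ F → indicator (class? 0 0 0 (eval F)) ≡ indicator (F ≟BF c₀) + indicator (F ≟BF c₁)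
  constant-or-not F = trans
    (indicator-cong (class? 0 0 0 (eval F)) ((F ≟BF c₀) ⊎-dec (F ≟BF c₁)) (class₀⇒constant F)
      λ { (inj₁ refl) → constantBF-class false ; (inj₂ refl) → constantBF-class true })
    (indicator-⊎ (F ≟BF c₀) (F ≟BF c₁) λ (e₀ , e₁) → c₀≢c₁ (trans (sym e₀) e₁))

numEssential≤ : ∀ {n} (f : Fun n) → numEssential f ≤ n
numEssential≤ {n} f =
  ℕ.≤-trans (List.length-filter (essential? f) (List.allFin n)) (ℕ.≤-reflexive (List.length-tabulate (λ i → i)))

Cnt≡∑N : ∀ n k r → Cnt n k r ≡ sum (map (λ i → N n i k r) (upTo (suc n)))
Cnt≡∑N n k r = begin
  Cnt n k r
    ≡⟨ length-filter≡sum (λ F → shape? (eval F)) (allBF n) ⟩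
  sum (map (λ F → indicator (shape? (eval F))) (allBF n))
    ≡⟨ sum-map-cong split-by-essentials (allBF n) ⟨
  sum (map (λ F → sum (map (λ i → indicator (class? i k r (eval F))) (upTo (suc n)))) (allBF n))
    ≡⟨ sum-map-comm (λ F i → indicator (class? i k r (eval F))) (allBF n) (upTo (suc n)) ⟩
  sum (map (λ i → sum (map (λ F → indicator (class? i k r (eval F))) (allBF n))) (upTo (suc n)))
    ≡⟨ sum-map-cong (λ i → length-filter≡sum (class? i k r ∘ eval) (allBF n)) (upTo (suc n)) ⟨
  sum (map (λ i → N n i k r) (upTo (suc n))) ∎
  where
  shape? : (f : Fun n) → Dec (HasDepth f k × HasLayers f r)
  shape? f = hasDepth? f k ×-dec hasLayers? f r
  split-by-essentials : ∀ F → sum (map (λ i → indicator (class? i k r (eval F))) (upTo (suc n))) ≡ indicator (shape? (eval F))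
  split-by-essentials F = begin
    sum (map (λ i → indicator (class? i k r (eval F))) (upTo (suc n)))
      ≡⟨ sum-map-cong (λ i → indicator-× (numEssential (eval F) ≟ℕ i) (shape? (eval F))) (upTo (suc n)) ⟩
    sum (map (λ i → indicator (numEssential (eval F) ≟ℕ i) * indicator (shape? (eval F))) (upTo (suc n)))
      ≡⟨ sum-map-*ʳ (λ i → indicator (numEssential (eval F) ≟ℕ i)) _ (upTo (suc n)) ⟩
    sum (map (λ i → indicator (numEssential (eval F) ≟ℕ i)) (upTo (suc n))) * indicator (shape? (eval F))
      ≡⟨ cong (_* indicator (shape? (eval F))) (sum-upTo-δ (numEssential (eval F)) (suc n)) ⟩
    indicator (numEssential (eval F) ℕ.<? suc n) * indicator (shape? (eval F))
      ≡⟨ cong (_* indicator (shape? (eval F)))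
              (indicator-yes (numEssential (eval F) ℕ.<? suc n) (s≤s (numEssential≤ (eval F)))) ⟩
    1 * indicator (shape? (eval F))
      ≡⟨ ℕ.*-identityˡ _ ⟩
    indicator (shape? (eval F)) ∎

N-complement : ∀ n k r → + N n n k r ≡ + Cnt n k r - + sum (map (λ i → N n i k r) (upTo n))
N-complement n k r = sym (begin
  + Cnt n k r - + S              ≡⟨ cong (λ c → + c - + S) (trans (Cnt≡∑N n k r) (sum-map-upTo-suc (λ i → N n i k r) n)) ⟩
  + (S + N n n k r) - + S        ≡⟨ ℤ.[+m]-[+n]≡m⊖n (S + N n n k r) S ⟩
  (S + N n n k r) ⊖ S            ≡⟨ ℤ.⊖-≥ (ℕ.m≤m+n S (N n n k r)) ⟩
  + (S + N n n k r ∸ S)          ≡⟨ cong +_ (ℕ.m+n∸m≡n S (N n n k r)) ⟩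
  + N n n k r                    ∎)
  where
  S = sum (map (λ i → N n i k r) (upTo n))

corollary1 : ∀ (n m k r : ℕ) → m ≤ n → k ≤ n → r ≤ n →
    ((m < k ⊎ k < r) → N n m k r ≡ 0) ×
    (m ≡ 0 → k ≡ 0 → r ≡ 0 → N n m k r ≡ 2) ×
    (k ≤ m → m < n → N n m k r ≡ (n C m) * N m m k r) ×
    (m ≡ n → + N n m k r ≡ + Cnt n k r - + sum (map (λ i → N n i k r) (upTo n)))
corollary1 n m k r m≤n k≤n r≤n =
  N-vanishes n m k r ,
  (λ { refl refl refl → N-constants n }) ,
  (λ _ m<n → N-binomial k r (ℕ.<⇒≤ m<n)) ,
  (λ { refl → N-complement n k r })
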